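{- Let $n\ge 2$, let $F$ be a face of the Steinberg torus of type $A_{n-1}$, identified with a spin necklace on $[n]$, and let $G$ be a face of the Coxeter complex of type $A_{n-1}$, identified with a composition $(S_1,\dots,S_k)$ of $[n]$. Then the spin necklace of the face $FG$ is obtained from that of $F$ by replacing each block $B$ by the string of blocks $B\cap S_1,\dots,B\cap S_k$ in this (clockwise) order, deleting the empty ones, where the edge incoming to $B$ becomes incoming to the first nonempty $B\cap S_i$ with the same label, the edge outgoing from $B$ becomes outgoing from the last nonempty $B\cap S_i$ with the same label, and the labels of the new intermediate edges are the unique ones satisfying the spin necklace condition.
   Context: Let $V_n=\{x\in\mathbb{R}^n:\sum x_i=0\}$. The Coxeter arrangement of type $A_{n-1}$ is $\{x_i=x_j: i<j\}$; its faces (nonempty sets obtained by prescribing for each $i<j$ whether $x_i<x_j$, $x_i=x_j$ or $x_i>x_j$) correspond bijectively to compositions $(S_1,\dots,S_k)$ of $[n]=\{1,\dots,n\}$ (ordered sequences of disjoint nonempty blocks with union $[n]$) via: $x_i=x_j$ if $i,j$ lie in the same block, $x_i<x_j$ if the block of $i$ precedes that of $j$. The affine arrangement is $\{x_j-x_i=k: i<j, k\in\mathbb{Z}\}$ in $V_n$; its faces are defined similarly. The coroot lattice $L=\{x\in\mathbb{Z}^n:\sum x_i=0\}$ acts on affine faces by translation; the Steinberg torus is the set of orbits $\overline F$. For an affine face $F$ and a Coxeter face $G$, $FG$ is the affine face containing $\lambda+tv$ for all small $t>0$ ($\lambda\in F$, $v\in G$), and $\overline F G:=\overline{FG}$ (well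 defined). A spin necklace on $[n]$ is a set partition of $[n]$ with a cyclic order on its blocks (drawn clockwise) and a labeling of the edges of the cycle by integers in $\{1,\dots,n\}$ such that for each block $B$ with incoming edge label $i$ and outgoing edge label $j$, $j\equiv i+|B|\pmod n$. The clasp is the block whose incoming edge has the maximal label and outgoing edge the minimal label. Spin necklaces correspond bijectively to Steinberg torus faces as follows. Let $C$ be the clasp with incoming label $\ell$ and outgoing label $r$ (so $\ell+|C|=r+n$); let $C_1$ be the $n-\ell$ smallest elements of $C$ and $C_2$ the $r$ largest. List the blocks as $C_2,R,\dots,L,C_1$ (following the cyclic order from the clasp, $C_1$ possibly empty). The corresponding torus face is the orbit of the affine face given by: $x_i=x_j$ if $i,j$ are in the same listed block; $x_i<x_j$ if the block of $i$ precedes that of $j$ in this list; $x_i=x_j+1$ if $i\in C_1$, $j\in C_2$; and, when $C_1=\emptyset$, $x_i<x_j+1$ for $i$ in the last listed block $L$ and $j\in C_2$.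
   Formalization: Points of $V_n$, among them λ ∈ F and v ∈ G, have rational coordinates instead of real ones, and the parameter t and its smallness bound are rational. -}

module Defs where

open import Data.Bool using (Bool; true; false; _∧_; if_then_else_)
open import Data.Nat as ℕ using (ℕ; zero; suc; _∸_; _%_; NonZero; _<ᵇ_)
  renaming (_+_ to _+ℕ_; _≤_ to _≤ℕ_; _<_ to _<ℕ_)
open import Data.Integer as ℤ using (ℤ)
open import Data.Rational using (ℚ; 0ℚ; 1ℚ; _+_; _*_; _-_; _<_; _≤_; _/_)
open import Data.Fin using (Fin; toℕ) renaming (zero to fzero; suc to fsuc)
open import Data.Fin.Subset using (Subset; _∈_; _∩_; ∣_∣; Nonempty)
open import Data.Fin.Subset.Properties using (_∈?_; nonempty?)
open import Data.Vec using (tabulate)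
open import Data.List using (List; []; _∷_; _++_; map; filter; length; zip; concatMap)
open import Data.List.Relation.Unary.All using (All)
open import Data.Product using (Σ; _×_; _,_; proj₁; proj₂; ∃)
open import Function using (_∘_)
open import Relation.Nullary using (does; ¬_)
open import Relation.Binary.PropositionalEquality using (_≡_)

-- Points of ℚ^n (ℚ is used in place of ℝ)

Point : ℕ → Set
Point n = Fin n → ℚ

sumℚ : ∀ {n} → (Fin n → ℚ) → ℚ
sumℚ {zero}  f = 0ℚ
sumℚ {suc n} f = f fzero + sumℚ (f ∘ fsuc)

sumℤ : ∀ {n} → (Fin n → ℤ) → ℤ
sumℤ {zero}  f = ℤ.+ 0
sumℤ {suc n} f = f fzero ℤ.+ sumℤ (f ∘ fsuc)

InV : ∀ {n} → Point n → Set
InV x = sumℚ x ≡ 0ℚ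

InL : ∀ {n} → (Fin n → ℤ) → Set
InL ℓ = sumℤ ℓ ≡ ℤ.+ 0

_+[_]·_ : ∀ {n} → Point n → ℚ → Point n → Point n
(x +[ t ]· v) i = x i + t * v i

shift : ∀ {n} → Point n → (Fin n → ℤ) → Point n
shift x ℓ i = x i - (ℓ i / 1)

countBlocks : ∀ {n} → Fin n → List (Subset n) → ℕ
countBlocks i Ps = length (filter (i ∈?_) Ps)

IsOrderedPartition : ∀ {n} → List (Subset n) → Set
IsOrderedPartition {n} Ps = All Nonempty Ps × (∀ (i : Fin n) → countBlocks i Ps ≡ 1)

-- index (0-based) of the block containing i  (length of the list if none)
blockIndex : ∀ {n} → List (Subset n) → Fin n → ℕ
blockIndex []       i = 0
blockIndex (P ∷ Ps) i = if does (i ∈? P) then 0 else suc (blockIndex Ps i)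

OrderedBy : ∀ {n} → List (Subset n) → Point n → Set
OrderedBy {n} Ps x = ∀ (i j : Fin n) →
  (blockIndex Ps i ≡ blockIndex Ps j → x i ≡ x j) ×
  (blockIndex Ps i <ℕ blockIndex Ps j → x i < x j)

IsComposition : ∀ {n} → List (Subset n) → Set
IsComposition = IsOrderedPartition

InCoxeterFace : ∀ {n} → List (Subset n) → Point n → Set
InCoxeterFace S v = InV v × OrderedBy S v

-- Spin necklaces
-- A necklace is a list of pairs (B , a): the blocks in clockwise cyclic
-- order starting from an arbitrary block, a = label of the edge
-- incoming to B.  The edge outgoing from B is the edge incoming to the
-- next block (cyclically).

Necklace : ℕ → Set
Necklace n = List (Subset n × ℕ)

rotate : ∀ {A : Set} → List A → List A
rotate []       = []
rotate (x ∷ xs) = xs ++ (x ∷ [])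

blocks : ∀ {n} → Necklace n → List (Subset n)
blocks = map proj₁

withNext : ∀ {n} → Necklace n → List ((Subset n × ℕ) × (Subset n × ℕ))
withNext N = zip N (rotate N)

SpinCond : ∀ {n} → .{{_ : NonZero n}} → (Subset n × ℕ) × (Subset n × ℕ) → Set
SpinCond {n} ((B , i) , (_ , j)) = (i +ℕ ∣ B ∣) % n ≡ j % n

LabelInRange : ∀ {n} → Subset n × ℕ → Set
LabelInRange {n} (_ , a) = (1 ≤ℕ a) × (a ≤ℕ n)

IsSpinNecklace : ∀ {n} → .{{_ : NonZero n}} → Necklace n → Set
IsSpinNecklace N =
  IsOrderedPartition (blocks N) × All LabelInRange N × All SpinCond (withNext N)

headLabel : ∀ {n} → ℕ → Necklace n → ℕ
headLabel d []            = d
headLabel d ((_ , a) ∷ _) = a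

lastOr : ∀ {n} → Subset n → List (Subset n) → Subset n
lastOr d []       = d
lastOr d (P ∷ Ps) = lastOr P Ps

below above : ∀ {n} → Fin n → Subset n
below i = tabulate λ j → toℕ j <ᵇ toℕ i
above i = tabulate λ j → toℕ i <ᵇ toℕ j

smallest largest : ∀ {n} → ℕ → Subset n → Subset n
smallest k C = tabulate λ i → does (i ∈? C) ∧ (∣ C ∩ below i ∣ <ᵇ k)
largest  k C = tabulate λ i → does (i ∈? C) ∧ (∣ C ∩ above i ∣ <ᵇ k)

-- A way of reading N starting at its clasp:  N = ys ++ (C , ℓ) ∷ zs,
-- where the incoming label ℓ of C is maximal and its outgoing label r
-- is minimal among the edge labels.  The cyclic order from the clasp is
-- C , zs , ys.
record ClaspSplit {n} (N : Necklace n) : Set where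
  field
    ys : Necklace n
    C  : Subset n
    ℓ  : ℕ
    zs : Necklace n
    split : N ≡ ys ++ (C , ℓ) ∷ zs
  r : ℕ
  r = headLabel ℓ (zs ++ ys)
  field
    inMax  : All (λ e → proj₂ e ≤ℕ ℓ) N
    outMin : All (λ e → r ≤ℕ proj₂ e) N
  C₁ C₂ : Subset n
  C₁ = smallest (n ∸ ℓ) C
  C₂ = largest r C
  -- the listed blocks C₂ , R , … , L  (C₁ is appended at the end)
  listed : List (Subset n)
  listed = C₂ ∷ blocks (zs ++ ys)
  Lblock : Subset n
  Lblock = lastOr C₂ (blocks (zs ++ ys))

AffFaceCond : ∀ {n} {N : Necklace n} → ClaspSplit N → Point n → Set
AffFaceCond {n} s x =
  OrderedBy (listed ++ C₁ ∷ []) x ×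
  (∀ (i j : Fin n) → i ∈ C₁ → j ∈ C₂ → x i ≡ x j + 1ℚ) ×
  (¬ Nonempty C₁ → ∀ (i j : Fin n) → i ∈ Lblock → j ∈ C₂ → x i < x j + 1ℚ)
  where open ClaspSplit s

InAffFace : ∀ {n} → Necklace n → Point n → Set
InAffFace N x = InV x × Σ (ClaspSplit N) (λ s → AffFaceCond s x)

-- x lies in (some representative of) the Steinberg torus face of N
InTorusFace : ∀ {n} → Necklace n → Point n → Set
InTorusFace {n} N x = Σ (Fin n → ℤ) λ ℓ → InL ℓ × InAffFace N (shift x ℓ)

-- the unique label in {1,…,n} congruent to a + |P| mod n
nextLabel : ∀ {n} → .{{_ : NonZero n}} → ℕ → Subset n → ℕ
nextLabel {n} a P = suc ((a +ℕ ∣ P ∣ ∸ 1) % n)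

relabel : ∀ {n} → .{{_ : NonZero n}} → ℕ → List (Subset n) → Necklace n
relabel a []       = []
relabel a (P ∷ Ps) = (P , a) ∷ relabel (nextLabel a P) Ps

pieces : ∀ {n} → List (Subset n) → Subset n → List (Subset n)
pieces S B = filter nonempty? (map (B ∩_) S)

refine : ∀ {n} → .{{_ : NonZero n}} → List (Subset n) → Necklace n → Necklace n
refine S = concatMap (λ e → relabel (proj₂ e) (pieces S (proj₁ e)))

-- A point of the torus face of N is lam = y + ℓ with y in the affine face read from the clasp C and ℓ ∈ L.
-- Moving by t v keeps y constant on every block B and orders the pieces B ∩ Sᵢ by the values of v.
-- Along the refined necklace the labels grow by the sizes of the pieces, so they pass n inside C, at a
-- piece C' that becomes the new clasp. Shifting y by a lattice vector (C₁ down by one, the pieces of C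
-- before C' and the n ∸ ℓ' smallest elements of C' up by one) gives y', on whose blocks the pairs
-- (value of y', value of v) increase lexicographically along the new necklace; for t below the ratio of
-- the least gap between values of y' to the spread of v, y' + t v lies in the new affine face.

module Submission where

open import Defs
open import Data.Bool using (Bool; true; false; _∧_; _∨_; if_then_else_)
open import Data.Bool.Properties using (∧-zeroʳ; ∨-zeroʳ; ¬-not)
open import Data.Unit using (⊤; tt)
open import Data.Empty using (⊥; ⊥-elim)
open import Data.Nat using (ℕ; zero; suc; _∸_; _%_; NonZero; _<ᵇ_; z≤n; s≤s)
  renaming (_+_ to _+ℕ_; _≤_ to _≤ℕ_; _<_ to _<ℕ_; _⊓_ to _⊓ℕ_)
import Data.Nat.Properties as ℕP
open import Data.Nat.ListAction using (sum)
open import Data.Nat.ListAction.Properties using (sum-++)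
open import Data.Nat.DivMod using (%-distribˡ-+; m%n%n≡m%n; n%n≡0; m<n⇒m%n≡m; [m+n]%n≡m%n; m%n<n)
import Data.Nat.Solver as NS
open import Data.Integer as ℤ using (ℤ)
import Data.Integer.Properties as ℤP
import Data.Integer.Solver as ZS
open import Data.Rational as ℚ
  using (ℚ; 0ℚ; 1ℚ; _+_; _*_; _-_; _<_; _≤_; _/_; 1/_; Positive; NonNegative; positive; nonNegative)
import Data.Rational.Properties as ℚP
open import Data.Rational.Unnormalised using (mkℚᵘ; *≡*)
import Data.Rational.Unnormalised.Properties as ℚᵘP
open import Data.Rational.Solver
open import Data.Fin using (Fin; toℕ) renaming (zero to fzero; suc to fsuc)
import Data.Fin.Properties as FinP
open import Data.Fin.Subset using (Subset; _∈_; _∩_; _∪_; ∣_∣; Nonempty)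
open import Data.Fin.Subset.Properties using (_∈?_; nonempty?; ∣p∣≤n)
open import Data.Vec using ([]; _∷_; lookup; tabulate)
open import Data.Vec.Properties using ([]=⇒lookup; lookup⇒[]=; lookup-zipWith; lookup∘tabulate; tabulate-cong)
open import Data.List as List using (List; []; _∷_; _++_; map; filter; length; zip)
open import Data.List.Properties using (++-assoc; map-++; ∷-injectiveˡ; ∷-injectiveʳ)
open import Data.List.Relation.Unary.All as All using (All; []; _∷_)
import Data.List.Relation.Unary.All.Properties as AllP
open import Data.List.Relation.Unary.Any as Any using (Any; here; there)
import Data.List.Relation.Unary.Any.Properties as AnyP
open import Data.List.Relation.Unary.AllPairs as AllPairs using (AllPairs; []; _∷_)
import Data.List.Relation.Unary.AllPairs.Properties as APP
open import Data.List.Membership.Propositional using () renaming (_∈_ to _∈ₗ_)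
open import Data.List.Membership.Propositional.Properties
  using (∈-map⁺; ∈-allFin; ∈-cartesianProductWith⁺; ∈-cartesianProduct⁺)
import Data.List.Extrema
open import Data.Product using (Σ; _×_; _,_; proj₁; proj₂)
open import Data.Sum as Sum using (_⊎_; inj₁; inj₂)
open import Function using (_∘_; id; case_of_)
open import Relation.Binary.Bundles using (DecTotalOrder)
open import Relation.Binary.PropositionalEquality
open import Relation.Nullary using (Dec; does; ¬_; yes; no)
import Algebra.Properties.CommutativeMonoid.Sum as CommutativeMonoidSum

module ∑ℕ = CommutativeMonoidSum ℕP.+-0-commutativeMonoid
module ℚExtrema = Data.List.Extrema (DecTotalOrder.totalOrder ℚP.≤-decTotalOrder)

mem : ∀ {n} → Fin n → Subset n → Bool
mem i p = lookup p i

∈⇒mem : ∀ {n} {i : Fin n} {p} → i ∈ p → mem i p ≡ true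
∈⇒mem = []=⇒lookup

mem⇒∈ : ∀ {n} {i : Fin n} {p} → mem i p ≡ true → i ∈ p
mem⇒∈ {i = i} {p} = lookup⇒[]= i p

does-∈?≡mem : ∀ {n} (i : Fin n) (p : Subset n) → does (i ∈? p) ≡ mem i p
does-∈?≡mem fzero    (true ∷ p)  = refl
does-∈?≡mem fzero    (false ∷ p) = refl
does-∈?≡mem (fsuc i) (x ∷ p)     = does-∈?≡mem i p

mem-∩ : ∀ {n} (i : Fin n) p q → mem i (p ∩ q) ≡ mem i p ∧ mem i q
mem-∩ i p q = lookup-zipWith _∧_ i p q

mem-∪ : ∀ {n} (i : Fin n) p q → mem i (p ∪ q) ≡ mem i p ∨ mem i q
mem-∪ i p q = lookup-zipWith _∨_ i p q

mem-false : ∀ {n} {i : Fin n} {p} → ¬ i ∈ p → mem i p ≡ false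
mem-false {i = i} {p} i∉p with mem i p in eq
... | false = refl
... | true  = ⊥-elim (i∉p (mem⇒∈ eq))

mem-false-⊆ : ∀ {n} {P Q : Subset n} i → (mem i P ≡ true → mem i Q ≡ true) → mem i Q ≡ false → mem i P ≡ false
mem-false-⊆ i P⊆Q i∉Q = ¬-not (λ i∈P → case trans (sym (P⊆Q i∈P)) i∉Q of λ ())

[_]b : Bool → ℕ
[ true ]b  = 1
[ false ]b = 0

[b]≤1 : ∀ b → [ b ]b ≤ℕ 1
[b]≤1 true  = s≤s z≤n
[b]≤1 false = z≤n

[b]≤0⇒false : ∀ {b} → [ b ]b ≤ℕ 0 → b ≡ false
[b]≤0⇒false {false} _ = refl

Σf : ∀ {n} → (Fin n → ℕ) → ℕ
Σf = ∑ℕ.sum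

Σf-1 : ∀ {n} → Σf {n} (λ _ → 1) ≡ n
Σf-1 {zero}  = refl
Σf-1 {suc n} = cong suc (Σf-1 {n})

card : ∀ {n} → Subset n → ℕ
card p = Σf (λ i → [ mem i p ]b)

∣p∣≡card : ∀ {n} (p : Subset n) → ∣ p ∣ ≡ card p
∣p∣≡card []          = refl
∣p∣≡card (true ∷ p)  = cong suc (∣p∣≡card p)
∣p∣≡card (false ∷ p) = ∣p∣≡card p

countBlocks-∷ : ∀ {n} (i : Fin n) P Ps → countBlocks i (P ∷ Ps) ≡ [ mem i P ]b +ℕ countBlocks i Ps
countBlocks-∷ i P Ps with does (i ∈? P) | does-∈?≡mem i P
... | true  | e rewrite sym e = refl
... | false | e rewrite sym e = refl

countBlocks-++ : ∀ {n} (i : Fin n) Ps Qs → countBlocks i (Ps ++ Qs) ≡ countBlocks i Ps +ℕ countBlocks i Qs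
countBlocks-++ i []       Qs = refl
countBlocks-++ i (P ∷ Ps) Qs = begin
  countBlocks i (P ∷ Ps ++ Qs)                           ≡⟨ countBlocks-∷ i P (Ps ++ Qs) ⟩
  [ mem i P ]b +ℕ countBlocks i (Ps ++ Qs)               ≡⟨ cong ([ mem i P ]b +ℕ_) (countBlocks-++ i Ps Qs) ⟩
  [ mem i P ]b +ℕ (countBlocks i Ps +ℕ countBlocks i Qs) ≡⟨ sym (ℕP.+-assoc [ mem i P ]b _ _) ⟩
  ([ mem i P ]b +ℕ countBlocks i Ps) +ℕ countBlocks i Qs
    ≡⟨ cong (_+ℕ countBlocks i Qs) (sym (countBlocks-∷ i P Ps)) ⟩
  countBlocks i (P ∷ Ps) +ℕ countBlocks i Qs             ∎
  where open ≡-Reasoning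

sizes : ∀ {n} → List (Subset n) → ℕ
sizes Ps = sum (map ∣_∣ Ps)

sizes-++ : ∀ {n} (Ps Qs : List (Subset n)) → sizes (Ps ++ Qs) ≡ sizes Ps +ℕ sizes Qs
sizes-++ Ps Qs = trans (cong sum (map-++ ∣_∣ Ps Qs)) (sum-++ (map ∣_∣ Ps) (map ∣_∣ Qs))

sizes≡Σf-countBlocks : ∀ {n} (Ps : List (Subset n)) → sizes Ps ≡ Σf (λ i → countBlocks i Ps)
sizes≡Σf-countBlocks {n} [] = sym (∑ℕ.sum-replicate-zero n)
sizes≡Σf-countBlocks (P ∷ Ps) = begin
  ∣ P ∣ +ℕ sizes Ps                                     ≡⟨ cong₂ _+ℕ_ (∣p∣≡card P) (sizes≡Σf-countBlocks Ps) ⟩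
  card P +ℕ Σf (λ i → countBlocks i Ps)
    ≡⟨ sym (∑ℕ.∑-distrib-+ (λ i → [ mem i P ]b) (λ i → countBlocks i Ps)) ⟩
  Σf (λ i → [ mem i P ]b +ℕ countBlocks i Ps)          ≡⟨ ∑ℕ.sum-cong-≗ (λ i → sym (countBlocks-∷ i P Ps)) ⟩
  Σf (λ i → countBlocks i (P ∷ Ps))                    ∎
  where open ≡-Reasoning

∣∩false∣ : ∀ {n} (C : Subset n) → ∣ C ∩ tabulate (λ _ → false) ∣ ≡ 0
∣∩false∣ [] = refl
∣∩false∣ (true ∷ C) = ∣∩false∣ C
∣∩false∣ (false ∷ C) = ∣∩false∣ C

∣∩true∣ : ∀ {n} (C : Subset n) → ∣ C ∩ tabulate (λ _ → true) ∣ ≡ ∣ C ∣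
∣∩true∣ [] = refl
∣∩true∣ (true ∷ C) = cong suc (∣∩true∣ C)
∣∩true∣ (false ∷ C) = ∣∩true∣ C

smallest-∷ : ∀ {n} k x (C : Subset n) → smallest k (x ∷ C) ≡ (x ∧ (0 <ᵇ k)) ∷ smallest (k ∸ [ x ]b) C
smallest-∷ k true C = cong₂ _∷_ (cong (_<ᵇ k) (∣∩false∣ C)) (tabulate-cong λ i → lem k i)
  where
  lem : ∀ k i → (does (i ∈? C) ∧ (suc ∣ C ∩ below i ∣ <ᵇ k)) ≡ (does (i ∈? C) ∧ (∣ C ∩ below i ∣ <ᵇ (k ∸ 1)))
  lem zero i = refl
  lem (suc k) i = refl
smallest-∷ k false C = cong₂ _∷_ refl (tabulate-cong λ i → refl)

largest-∷ : ∀ {n} m x (C : Subset n) → largest m (x ∷ C) ≡ (x ∧ (∣ C ∣ <ᵇ m)) ∷ largest m C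
largest-∷ m true C = cong₂ _∷_ (cong (_<ᵇ m) (∣∩true∣ C)) (tabulate-cong λ i → refl)
largest-∷ m false C = cong₂ _∷_ refl (tabulate-cong λ i → refl)

smallest⊆ : ∀ {n} k (C : Subset n) i → mem i (smallest k C) ≡ true → mem i C ≡ true
smallest⊆ k C i e with does (i ∈? C) | does-∈?≡mem i C | trans (sym (lookup∘tabulate _ i)) e
... | true | d | _ = sym d
... | false | d | ()

largest⊆ : ∀ {n} k (C : Subset n) i → mem i (largest k C) ≡ true → mem i C ≡ true
largest⊆ k C i e with does (i ∈? C) | does-∈?≡mem i C | trans (sym (lookup∘tabulate _ i)) e
... | true | d | _ = sym d
... | false | d | ()

smallest-0 : ∀ {n} (C : Subset n) i → mem i (smallest 0 C) ≡ false
smallest-0 C i = trans (lookup∘tabulate _ i) (∧-zeroʳ _)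

<ᵇ⇒< : ∀ {a b} → (a <ᵇ b) ≡ true → a <ℕ b
<ᵇ⇒< {zero} {suc b} e = s≤s z≤n
<ᵇ⇒< {suc a} {suc b} e = s≤s (<ᵇ⇒< {a} {b} e)

<⇒<ᵇ : ∀ {a b} → a <ℕ b → (a <ᵇ b) ≡ true
<⇒<ᵇ {zero} (s≤s p) = refl
<⇒<ᵇ {suc a} (s≤s p) = <⇒<ᵇ p

∣smallest∣ : ∀ {n} k (C : Subset n) → ∣ smallest k C ∣ ≡ k ⊓ℕ ∣ C ∣
∣smallest∣ k [] = sym (ℕP.⊓-zeroʳ k)
∣smallest∣ k (x ∷ C) = trans (cong ∣_∣ (smallest-∷ k x C)) (go k x)
  where
  go : ∀ k x → ∣ (x ∧ (0 <ᵇ k)) ∷ smallest (k ∸ [ x ]b) C ∣ ≡ k ⊓ℕ ∣ x ∷ C ∣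
  go zero true = ∣smallest∣ 0 C
  go (suc k) true = cong suc (∣smallest∣ k C)
  go k false = ∣smallest∣ k C

∣largest∣ : ∀ {n} m (C : Subset n) → ∣ largest m C ∣ ≡ m ⊓ℕ ∣ C ∣
∣largest∣ m [] = sym (ℕP.⊓-zeroʳ m)
∣largest∣ m (x ∷ C) = trans (cong ∣_∣ (largest-∷ m x C)) (go x)
  where
  go : ∀ x → ∣ (x ∧ (∣ C ∣ <ᵇ m)) ∷ largest m C ∣ ≡ m ⊓ℕ ∣ x ∷ C ∣
  go false = ∣largest∣ m C
  go true with ∣ C ∣ <ᵇ m in eq
  ... | true = begin
      suc ∣ largest m C ∣ ≡⟨ cong suc (∣largest∣ m C) ⟩
      suc (m ⊓ℕ ∣ C ∣) ≡⟨ cong suc (ℕP.m≥n⇒m⊓n≡n (ℕP.<⇒≤ (<ᵇ⇒< eq))) ⟩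
      suc ∣ C ∣ ≡⟨ sym (ℕP.m≥n⇒m⊓n≡n (<ᵇ⇒< eq)) ⟩
      m ⊓ℕ suc ∣ C ∣ ∎
    where open ≡-Reasoning
  ... | false = begin
      ∣ largest m C ∣ ≡⟨ ∣largest∣ m C ⟩
      m ⊓ℕ ∣ C ∣ ≡⟨ ℕP.m≤n⇒m⊓n≡m m≤C ⟩
      m ≡⟨ sym (ℕP.m≤n⇒m⊓n≡m (ℕP.m≤n⇒m≤1+n m≤C)) ⟩
      m ⊓ℕ suc ∣ C ∣ ∎
    where
    open ≡-Reasoning
    m≤C : m ≤ℕ ∣ C ∣
    m≤C = ℕP.≮⇒≥ (λ lt → case trans (sym (<⇒<ᵇ lt)) eq of λ ())

smallest-largest-disjoint : ∀ {n} k m (C : Subset n) i → k +ℕ m ≤ℕ ∣ C ∣ →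
  mem i (smallest k C) ≡ true → mem i (largest m C) ≡ true → ⊥
smallest-largest-disjoint zero m C i le e1 e2 = case trans (sym e1) (smallest-0 C i) of λ ()
smallest-largest-disjoint (suc k) m (x ∷ C) fzero le e1 e2 = go x le (trans (sym (cong (mem fzero) (largest-∷ m x C))) e2)
  where
  go : ∀ x → suc k +ℕ m ≤ℕ ∣ x ∷ C ∣ → (x ∧ (∣ C ∣ <ᵇ m)) ≡ true → ⊥
  go true (s≤s le) e = ℕP.<⇒≱ (<ᵇ⇒< e) (ℕP.≤-trans (ℕP.m≤n+m m k) le)
  go false le ()
smallest-largest-disjoint (suc k) m (x ∷ C) (fsuc i) le e1 e2 = go x le (trans (sym (cong (mem (fsuc i)) (smallest-∷ (suc k) x C))) e1)
  where
  e2' : mem i (largest m C) ≡ true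
  e2' = trans (sym (cong (mem (fsuc i)) (largest-∷ m x C))) e2
  go : ∀ x → suc k +ℕ m ≤ℕ ∣ x ∷ C ∣ → mem i (smallest (suc k ∸ [ x ]b) C) ≡ true → ⊥
  go true (s≤s le) e = smallest-largest-disjoint k m C i le e e2'
  go false le e = smallest-largest-disjoint (suc k) m C i le e e2'

smallest-largest-cover : ∀ {n} k m (C : Subset n) i → ∣ C ∣ ≤ℕ k +ℕ m → mem i C ≡ true →
  (mem i (smallest k C) ≡ true) ⊎ (mem i (largest m C) ≡ true)
smallest-largest-cover k m (x ∷ C) fzero le e =
  Sum.map (trans (cong (mem fzero) (smallest-∷ k x C))) (trans (cong (mem fzero) (largest-∷ m x C))) (go k x e le)
  where
  go : ∀ k x → x ≡ true → ∣ x ∷ C ∣ ≤ℕ k +ℕ m → ((x ∧ (0 <ᵇ k)) ≡ true) ⊎ ((x ∧ (∣ C ∣ <ᵇ m)) ≡ true)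
  go zero true refl le = inj₂ (<⇒<ᵇ le)
  go (suc k) true refl le = inj₁ refl
smallest-largest-cover k m (x ∷ C) (fsuc i) le e =
  Sum.map (trans (cong (mem (fsuc i)) (smallest-∷ k x C))) (trans (cong (mem (fsuc i)) (largest-∷ m x C)))
    (smallest-largest-cover (k ∸ [ x ]b) m C i (go k x le) e)
  where
  go : ∀ k x → ∣ x ∷ C ∣ ≤ℕ k +ℕ m → ∣ C ∣ ≤ℕ (k ∸ [ x ]b) +ℕ m
  go zero true le = ℕP.≤-trans (ℕP.n≤1+n _) le
  go (suc k) true (s≤s le) = le
  go k false le = le

module _ {n} (C : Subset n) {ℓ r : ℕ} (ℓ≤n : ℓ ≤ℕ n) (wraps : ℓ +ℕ ∣ C ∣ ≡ r +ℕ n) where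

  n∸ℓ+r≡∣C∣ : n ∸ ℓ +ℕ r ≡ ∣ C ∣
  n∸ℓ+r≡∣C∣ = ℕP.+-cancelʳ-≡ ℓ _ _ (begin
    n ∸ ℓ +ℕ r +ℕ ℓ  ≡⟨ NS.+-*-Solver.solve 3 (λ a b c → (a :+ b) :+ c := (a :+ c) :+ b) refl (n ∸ ℓ) r ℓ ⟩
    n ∸ ℓ +ℕ ℓ +ℕ r  ≡⟨ cong (_+ℕ r) (ℕP.m∸n+n≡m ℓ≤n) ⟩
    n +ℕ r           ≡⟨ ℕP.+-comm n r ⟩
    r +ℕ n           ≡⟨ wraps ⟨
    ℓ +ℕ ∣ C ∣       ≡⟨ ℕP.+-comm ℓ _ ⟩
    ∣ C ∣ +ℕ ℓ       ∎)
    where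
    open ≡-Reasoning
    open NS.+-*-Solver using (_:+_; _:=_)

  ∣smallest∣≡n∸ℓ : ∣ smallest (n ∸ ℓ) C ∣ ≡ n ∸ ℓ
  ∣smallest∣≡n∸ℓ = trans (∣smallest∣ (n ∸ ℓ) C) (ℕP.m≤n⇒m⊓n≡m (subst (n ∸ ℓ ≤ℕ_) n∸ℓ+r≡∣C∣ (ℕP.m≤m+n _ r)))

  ∣largest∣≡r : ∣ largest r C ∣ ≡ r
  ∣largest∣≡r = trans (∣largest∣ r C) (ℕP.m≤n⇒m⊓n≡m (subst (r ≤ℕ_) n∸ℓ+r≡∣C∣ (ℕP.m≤n+m r _)))

  smallest-largest-split : ∀ i → mem i C ≡ true → (mem i (smallest (n ∸ ℓ) C) ≡ true) ⊎ (mem i (largest r C) ≡ true)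
  smallest-largest-split i = smallest-largest-cover (n ∸ ℓ) r C i (ℕP.≤-reflexive (sym n∸ℓ+r≡∣C∣))

  smallest-largest-apart : ∀ i → mem i (smallest (n ∸ ℓ) C) ≡ true → mem i (largest r C) ≡ true → ⊥
  smallest-largest-apart i = smallest-largest-disjoint (n ∸ ℓ) r C i (ℕP.≤-reflexive n∸ℓ+r≡∣C∣)

Disjoint : ∀ {n} → Subset n → Subset n → Set
Disjoint P Q = ∀ i → mem i P ≡ true → mem i Q ≡ true → ⊥

InSome : ∀ {n} → Fin n → List (Subset n) → Set
InSome i Ps = Any (λ P → mem i P ≡ true) Ps

countBlocks≡0⇒disjoint : ∀ {n} (P : Subset n) Qs → (∀ i → mem i P ≡ true → countBlocks i Qs ≡ 0) →
                         All (Disjoint P) Qs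
countBlocks≡0⇒disjoint P [] h = []
countBlocks≡0⇒disjoint P (Q ∷ Qs) h = d ∷ countBlocks≡0⇒disjoint P Qs h'
  where
  d : Disjoint P Q
  d i eP eQ with trans (sym (countBlocks-∷ i Q Qs)) (h i eP)
  ... | e rewrite eQ = ℕP.1+n≢0 e
  h' : ∀ i → mem i P ≡ true → countBlocks i Qs ≡ 0
  h' i eP = ℕP.m+n≡0⇒n≡0 [ mem i Q ]b (trans (sym (countBlocks-∷ i Q Qs)) (h i eP))

countBlocks≤1⇒pairwiseDisjoint : ∀ {n} (Ps : List (Subset n)) → (∀ i → countBlocks i Ps ≤ℕ 1) → AllPairs Disjoint Ps
countBlocks≤1⇒pairwiseDisjoint [] h = []
countBlocks≤1⇒pairwiseDisjoint (P ∷ Ps) h = countBlocks≡0⇒disjoint P Ps h0 ∷ countBlocks≤1⇒pairwiseDisjoint Ps h1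
  where
  h0 : ∀ i → mem i P ≡ true → countBlocks i Ps ≡ 0
  h0 i eP with subst (_≤ℕ 1) (countBlocks-∷ i P Ps) (h i)
  ... | le rewrite eP = ℕP.n≤0⇒n≡0 (ℕP.+-cancelˡ-≤ 1 _ 0 le)
  h1 : ∀ i → countBlocks i Ps ≤ℕ 1
  h1 i = ℕP.≤-trans (ℕP.m≤n+m (countBlocks i Ps) [ mem i P ]b)
           (subst (_≤ℕ 1) (countBlocks-∷ i P Ps) (h i))

countBlocks≡0⇒∉ : ∀ {n} (i : Fin n) Ps → countBlocks i Ps ≡ 0 → All (λ P → mem i P ≡ false) Ps
countBlocks≡0⇒∉ i []       _ = []
countBlocks≡0⇒∉ i (P ∷ Ps) e with mem i P in eq | trans (sym (countBlocks-∷ i P Ps)) e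
... | false | e' = eq ∷ countBlocks≡0⇒∉ i Ps e'

countBlocks≥1⇒inSome : ∀ {n} (i : Fin n) Ps → 1 ≤ℕ countBlocks i Ps → InSome i Ps
countBlocks≥1⇒inSome i [] ()
countBlocks≥1⇒inSome i (P ∷ Ps) le with mem i P in eq
... | true = here eq
... | false = there (countBlocks≥1⇒inSome i Ps
                      (subst (1 ≤ℕ_) (trans (countBlocks-∷ i P Ps) (cong (λ b → [ b ]b +ℕ countBlocks i Ps) eq)) le))

inSome⇒countBlocks≥1 : ∀ {n} (i : Fin n) Ps → InSome i Ps → 1 ≤ℕ countBlocks i Ps
inSome⇒countBlocks≥1 i (P ∷ Ps) (here e) = subst (1 ≤ℕ_) (sym (countBlocks-∷ i P Ps))
  (subst (λ b → 1 ≤ℕ [ b ]b +ℕ countBlocks i Ps) (sym e) (s≤s z≤n))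
inSome⇒countBlocks≥1 i (P ∷ Ps) (there a) = subst (1 ≤ℕ_) (sym (countBlocks-∷ i P Ps))
  (ℕP.≤-trans (inSome⇒countBlocks≥1 i Ps a) (ℕP.m≤n+m _ _))

blockIndex-∷ : ∀ {n} (i : Fin n) P Ps → blockIndex (P ∷ Ps) i ≡ (if mem i P then 0 else suc (blockIndex Ps i))
blockIndex-∷ i P Ps rewrite does-∈?≡mem i P = refl

blockIndex-here : ∀ {n} (i : Fin n) P Ps → mem i P ≡ true → blockIndex (P ∷ Ps) i ≡ 0
blockIndex-here i P Ps e = trans (blockIndex-∷ i P Ps) (cong (λ b → if b then 0 else suc (blockIndex Ps i)) e)

blockIndex-there : ∀ {n} (i : Fin n) P Ps → mem i P ≡ false → blockIndex (P ∷ Ps) i ≡ suc (blockIndex Ps i)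
blockIndex-there i P Ps e = trans (blockIndex-∷ i P Ps) (cong (λ b → if b then 0 else suc (blockIndex Ps i)) e)

position : ∀ {n} {i : Fin n} {Ps} → InSome i Ps → ℕ
position p = toℕ (Any.index p)

blockIndex≡position : ∀ {n} (i : Fin n) Ps → AllPairs Disjoint Ps → (p : InSome i Ps) → blockIndex Ps i ≡ position p
blockIndex≡position i (P ∷ Ps) ap (here e) = blockIndex-here i P Ps e
blockIndex≡position i (P ∷ Ps) (d ∷ ap) (there p) =
  trans (blockIndex-there i P Ps notP) (cong suc (blockIndex≡position i Ps ap p))
  where
  notP : mem i P ≡ false
  notP with mem i P in eq
  ... | false = refl
  ... | true = ⊥-elim (go Ps d p)
    where
    go : ∀ Qs → All (Disjoint P) Qs → InSome i Qs → ⊥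
    go (Q ∷ Qs) (dq ∷ _) (here eQ) = dq i eq eQ
    go (Q ∷ Qs) (_ ∷ ds) (there a) = go Qs ds a

inSome-++ˡ : ∀ {n} {i : Fin n} {Ps} Qs → InSome i Ps → InSome i (Ps ++ Qs)
inSome-++ˡ Qs (here e) = here e
inSome-++ˡ Qs (there p) = there (inSome-++ˡ Qs p)

position-++ˡ : ∀ {n} {i : Fin n} {Ps} Qs (p : InSome i Ps) → position (inSome-++ˡ Qs p) ≡ position p
position-++ˡ Qs (here e) = refl
position-++ˡ Qs (there p) = cong suc (position-++ˡ Qs p)

inSome-++ʳ : ∀ {n} {i : Fin n} Ps {Qs} → InSome i Qs → InSome i (Ps ++ Qs)
inSome-++ʳ [] q = q
inSome-++ʳ (P ∷ Ps) q = there (inSome-++ʳ Ps q)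

position-++ʳ : ∀ {n} {i : Fin n} Ps {Qs} (q : InSome i Qs) → position (inSome-++ʳ Ps q) ≡ length Ps +ℕ position q
position-++ʳ [] q = refl
position-++ʳ (P ∷ Ps) q = cong suc (position-++ʳ Ps q)

position<length : ∀ {n} {i : Fin n} {Ps} (p : InSome i Ps) → position p <ℕ length Ps
position<length p = FinP.toℕ<n (Any.index p)

-- OrderedBy, stated for every witness of membership rather than through blockIndex.
PositionOrdered : ∀ {n} → List (Subset n) → Point n → Set
PositionOrdered Ps x = ∀ i j (p : InSome i Ps) (q : InSome j Ps) →
  (position p ≡ position q → x i ≡ x j) × (position p <ℕ position q → x i < x j)

orderedBy⇒positionOrdered : ∀ {n} (Ps : List (Subset n)) x → OrderedBy Ps x → AllPairs Disjoint Ps →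
                            PositionOrdered Ps x
orderedBy⇒positionOrdered Ps x ob ap i j p q =
  (λ e → proj₁ (ob i j) (trans (blockIndex≡position i Ps ap p) (trans e (sym (blockIndex≡position j Ps ap q))))) ,
  (λ lt → proj₂ (ob i j) (subst₂ _<ℕ_ (sym (blockIndex≡position i Ps ap p)) (sym (blockIndex≡position j Ps ap q)) lt))

positionOrdered-++ˡ : ∀ {n} (Ps Qs : List (Subset n)) x → PositionOrdered (Ps ++ Qs) x → PositionOrdered Ps x
positionOrdered-++ˡ Ps Qs x h i j p q =
  (λ e → proj₁ (h′ i j p q) (trans (position-++ˡ Qs p) (trans e (sym (position-++ˡ Qs q))))) ,
  (λ lt → proj₂ (h′ i j p q) (subst₂ _<ℕ_ (sym (position-++ˡ Qs p)) (sym (position-++ˡ Qs q)) lt))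
  where
  h′ : ∀ i j (p : InSome i Ps) (q : InSome j Ps) → _
  h′ i j p q = h i j (inSome-++ˡ Qs p) (inSome-++ˡ Qs q)

positionOrdered-∷ : ∀ {n} P (Ps : List (Subset n)) x → PositionOrdered (P ∷ Ps) x → PositionOrdered Ps x
positionOrdered-∷ P Ps x h i j p q =
  (λ e → proj₁ (h i j (there p) (there q)) (cong suc e)) ,
  (λ lt → proj₂ (h i j (there p) (there q)) (s≤s lt))

-- A list of pairs (block , value) records the value of a point on each block;
-- a face condition OrderedBy is the same as a strictly increasing such list.
Takes : ∀ {n} → Point n → List (Subset n × ℚ) → Set
Takes x PW = All (λ a → ∀ i → mem i (proj₁ a) ≡ true → x i ≡ proj₂ a) PW

Increasing : ∀ {n} → List (Subset n × ℚ) → Set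
Increasing PW = AllPairs (λ a b → proj₂ a < proj₂ b) PW

record Valuation {n} (Ps : List (Subset n)) (x : Point n) : Set where
  field
    PW : List (Subset n × ℚ)
    blocksEq : map proj₁ PW ≡ Ps
    vals : Takes x PW
    sorted : Increasing PW

witness : ∀ {n} {P : Subset n} → Nonempty P → Fin n
witness = proj₁

witness∈ : ∀ {n} {P : Subset n} (ne : Nonempty P) → mem (witness ne) P ≡ true
witness∈ ne = ∈⇒mem (proj₂ ne)

valuation : ∀ {n} (Ps : List (Subset n)) x → PositionOrdered Ps x → All Nonempty Ps → Valuation Ps x
valuation [] x h [] = record { PW = [] ; blocksEq = refl ; vals = [] ; sorted = [] }
valuation (P ∷ Ps) x h (ne ∷ nes) = record
  { PW = (P , x e) ∷ E.PW
  ; blocksEq = cong (P ∷_) E.blocksEq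
  ; vals = v0 ∷ E.vals
  ; sorted = go E.PW E.vals (subst (λ Qs → ∀ j → InSome j Qs → x e < x j) (sym E.blocksEq) hl)
                 (subst (All Nonempty) (sym E.blocksEq) nes) ∷ E.sorted }
  where
  module E = Valuation (valuation Ps x (positionOrdered-∷ P Ps x h) nes)
  e = witness ne
  v0 : ∀ i → mem i P ≡ true → x i ≡ x e
  v0 i m = proj₁ (h i e (here m) (here (witness∈ ne))) refl
  hl : ∀ j (q : InSome j Ps) → x e < x j
  hl j q = proj₂ (h e j (here (witness∈ ne)) (there q)) (s≤s z≤n)
  go : ∀ PW → Takes x PW → (∀ j → InSome j (map proj₁ PW) → x e < x j) → All Nonempty (map proj₁ PW) →
       All (λ b → x e < proj₂ b) PW
  go [] _ _ _ = []
  go ((Q , w) ∷ PW) (vq ∷ vs) hh (neq ∷ nes) =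
    subst (x e <_) (vq (witness neq) (witness∈ neq)) (hh (witness neq) (here (witness∈ neq))) ∷
    go PW vs (λ j a → hh j (there a)) nes

inSome-tail : ∀ {n} {i : Fin n} {P Ps} → mem i P ≡ false → InSome i (P ∷ Ps) → InSome i Ps
inSome-tail e (here e') = case trans (sym e') e of λ ()
inSome-tail e (there a) = a

value-inSome : ∀ {n} {i : Fin n} x (PW : List (Subset n × ℚ)) (R : ℚ → Set) → InSome i (map proj₁ PW) → Takes x PW →
         All (λ b → R (proj₂ b)) PW → R (x i)
value-inSome x ((P , w) ∷ PW) R (here e) (v ∷ _) (r ∷ _) = subst R (sym (v _ e)) r
value-inSome x ((P , w) ∷ PW) R (there a) (_ ∷ vs) (_ ∷ rs) = value-inSome x PW R a vs rs

inSome-own : ∀ {n} (PW : List (Subset n × ℚ)) →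
             All (λ e → ∀ i → mem i (proj₁ e) ≡ true → InSome i (map proj₁ PW)) PW
inSome-own []       = []
inSome-own (x ∷ PW) = (λ i m → here m) ∷ All.map (λ h i m → there (h i m)) (inSome-own PW)

pointwise⇒values : ∀ {n} (x : Point n) (R : ℚ → Set) PW → (∀ i → InSome i (map proj₁ PW) → R (x i)) →
                   Takes x PW → All (Nonempty ∘ proj₁) PW → All (λ b → R (proj₂ b)) PW
pointwise⇒values x R []       _ _         _          = []
pointwise⇒values x R (q ∷ PW) h (vq ∷ vs) (ne ∷ nes) =
  subst R (vq (witness ne) (witness∈ ne)) (h (witness ne) (here (witness∈ ne))) ∷
  pointwise⇒values x R PW (λ j a → h j (there a)) vs nes

orderedBy-pair : ∀ {n} (PW : List (Subset n × ℚ)) x → Increasing PW → Takes x PW → ∀ i j →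
  InSome i (map proj₁ PW) → InSome j (map proj₁ PW) →
  (blockIndex (map proj₁ PW) i ≡ blockIndex (map proj₁ PW) j → x i ≡ x j) ×
  (blockIndex (map proj₁ PW) i <ℕ blockIndex (map proj₁ PW) j → x i < x j)
orderedBy-pair ((P , w) ∷ PW) x (s ∷ ss) (v ∷ vs) i j ai aj with mem i P in ei | mem j P in ej
... | true | true =
  (λ _ → trans (v i ei) (sym (v j ej))) ,
  (λ lt → ⊥-elim (ℕP.n≮0 (subst₂ _<ℕ_ (blockIndex-here i P Qs ei) (blockIndex-here j P Qs ej) lt)))
  where Qs = map proj₁ PW
... | true | false =
  (λ e → ⊥-elim (ℕP.0≢1+n (trans (sym (blockIndex-here i P Qs ei)) (trans e (blockIndex-there j P Qs ej))))) ,
  (λ _ → subst (_< x j) (sym (v i ei)) (value-inSome x PW (w <_) (inSome-tail ej aj) vs s))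
  where Qs = map proj₁ PW
... | false | true =
  (λ e → ⊥-elim (ℕP.0≢1+n (trans (sym (blockIndex-here j P Qs ej)) (trans (sym e) (blockIndex-there i P Qs ei))))) ,
  (λ lt → ⊥-elim (ℕP.n≮0 (subst₂ _<ℕ_ (blockIndex-there i P Qs ei) (blockIndex-here j P Qs ej) lt)))
  where Qs = map proj₁ PW
... | false | false =
  (λ e → proj₁ rec (ℕP.suc-injective (trans (sym (blockIndex-there i P Qs ei)) (trans e (blockIndex-there j P Qs ej))))) ,
  (λ lt → proj₂ rec (ℕP.≤-pred (subst₂ _<ℕ_ (blockIndex-there i P Qs ei) (blockIndex-there j P Qs ej) lt)))
  where
  Qs = map proj₁ PW
  rec = orderedBy-pair PW x ss vs i j (inSome-tail ei ai) (inSome-tail ej aj)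

orderedBy-fromValues : ∀ {n} (PW : List (Subset n × ℚ)) x → Increasing PW → Takes x PW →
                       (∀ i → InSome i (map proj₁ PW)) → OrderedBy (map proj₁ PW) x
orderedBy-fromValues PW x ss vs cov i j = orderedBy-pair PW x ss vs i j (cov i) (cov j)

nonempty⇒1≤∣p∣ : ∀ {n} {P : Subset n} → Nonempty P → 1 ≤ℕ ∣ P ∣
nonempty⇒1≤∣p∣ {P = P} ne = go P (witness ne) (witness∈ ne)
  where
  go : ∀ {n} (P : Subset n) i → mem i P ≡ true → 1 ≤ℕ ∣ P ∣
  go (true ∷ P)  fzero    e = s≤s z≤n
  go (true ∷ P)  (fsuc i) e = s≤s z≤n
  go (false ∷ P) (fsuc i) e = go P i e

1≤∣p∣⇒nonempty : ∀ {n} (P : Subset n) → 1 ≤ℕ ∣ P ∣ → Nonempty P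
1≤∣p∣⇒nonempty (true ∷ P) _ = fzero , mem⇒∈ {i = fzero} {p = true ∷ P} refl
1≤∣p∣⇒nonempty (false ∷ P) le with 1≤∣p∣⇒nonempty P le
... | i , p = fsuc i , mem⇒∈ {i = fsuc i} {p = false ∷ P} (∈⇒mem p)

countBlocks-filterNonempty : ∀ {n} (i : Fin n) Xs → countBlocks i (filter nonempty? Xs) ≡ countBlocks i Xs
countBlocks-filterNonempty i [] = refl
countBlocks-filterNonempty i (X ∷ Xs) with nonempty? X
... | yes _ = begin
  countBlocks i (X ∷ filter nonempty? Xs)       ≡⟨ countBlocks-∷ i X _ ⟩
  [ mem i X ]b +ℕ countBlocks i (filter nonempty? Xs)
    ≡⟨ cong ([ mem i X ]b +ℕ_) (countBlocks-filterNonempty i Xs) ⟩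
  [ mem i X ]b +ℕ countBlocks i Xs              ≡⟨ countBlocks-∷ i X Xs ⟨
  countBlocks i (X ∷ Xs)                        ∎
  where open ≡-Reasoning
... | no X-empty = begin
  countBlocks i (filter nonempty? Xs)           ≡⟨ countBlocks-filterNonempty i Xs ⟩
  [ false ]b +ℕ countBlocks i Xs
    ≡⟨ cong (λ b → [ b ]b +ℕ countBlocks i Xs) (mem-false (λ m → X-empty (i , m))) ⟨
  [ mem i X ]b +ℕ countBlocks i Xs              ≡⟨ countBlocks-∷ i X Xs ⟨
  countBlocks i (X ∷ Xs)                        ∎
  where open ≡-Reasoning

countBlocks-map-∩ : ∀ {n} (i : Fin n) B Ss →
  countBlocks i (map (B ∩_) Ss) ≡ (if mem i B then countBlocks i Ss else 0)
countBlocks-map-∩ i B [] with mem i B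
... | true  = refl
... | false = refl
countBlocks-map-∩ i B (S ∷ Ss) = begin
  countBlocks i (B ∩ S ∷ map (B ∩_) Ss)
    ≡⟨ countBlocks-∷ i (B ∩ S) _ ⟩
  [ mem i (B ∩ S) ]b +ℕ countBlocks i (map (B ∩_) Ss)
    ≡⟨ cong₂ (λ b c → [ b ]b +ℕ c) (mem-∩ i B S) (countBlocks-map-∩ i B Ss) ⟩
  [ mem i B ∧ mem i S ]b +ℕ (if mem i B then countBlocks i Ss else 0)
    ≡⟨ push-if (mem i B) ⟩
  (if mem i B then [ mem i S ]b +ℕ countBlocks i Ss else 0)
    ≡⟨ cong (λ c → if mem i B then c else 0) (countBlocks-∷ i S Ss) ⟨
  (if mem i B then countBlocks i (S ∷ Ss) else 0) ∎
  where
  open ≡-Reasoning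
  push-if : ∀ b → [ b ∧ mem i S ]b +ℕ (if b then countBlocks i Ss else 0)
                  ≡ (if b then [ mem i S ]b +ℕ countBlocks i Ss else 0)
  push-if true  = refl
  push-if false = refl

module _ {n} (S : List (Subset n)) (S-partition : ∀ i → countBlocks i S ≡ 1) where

  countBlocks-pieces : ∀ i B → countBlocks i (pieces S B) ≡ [ mem i B ]b
  countBlocks-pieces i B with mem i B in eq
  ... | true  = trans (countBlocks-filterNonempty i (map (B ∩_) S))
                      (trans (countBlocks-map-∩ i B S) (trans (cong (λ b → if b then _ else 0) eq) (S-partition i)))
  ... | false = trans (countBlocks-filterNonempty i (map (B ∩_) S))
                      (trans (countBlocks-map-∩ i B S) (cong (λ b → if b then _ else 0) eq))

  sizes-pieces : ∀ B → sizes (pieces S B) ≡ ∣ B ∣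
  sizes-pieces B = begin
    sizes (pieces S B)                     ≡⟨ sizes≡Σf-countBlocks (pieces S B) ⟩
    Σf (λ i → countBlocks i (pieces S B))  ≡⟨ ∑ℕ.sum-cong-≗ (λ i → countBlocks-pieces i B) ⟩
    card B                                 ≡⟨ ∣p∣≡card B ⟨
    ∣ B ∣                                  ∎
    where open ≡-Reasoning

  pieces-nonempty : ∀ B → Nonempty B → Σ (Subset n) λ P → Σ (List (Subset n)) λ Ps → pieces S B ≡ P ∷ Ps
  pieces-nonempty B ne with pieces S B | sizes-pieces B
  ... | P ∷ Ps | _ = P , Ps , refl
  ... | []     | e = ⊥-elim (ℕP.<⇒≱ (nonempty⇒1≤∣p∣ ne) (ℕP.≤-reflexive (sym e)))

all-nonempty-pieces : ∀ {n} (S : List (Subset n)) B → All Nonempty (pieces S B)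
all-nonempty-pieces S B = AllP.all-filter nonempty? (map (B ∩_) S)

module Labels {n : ℕ} .{{_ : NonZero n}} where

  LabelsBetween : ℕ → ℕ → Necklace n → Set
  LabelsBetween lo hi = All (λ e → lo ≤ℕ proj₂ e × proj₂ e ≤ℕ hi)

  SpinStep : ℕ → Subset n → ℕ → Set
  SpinStep a B j = (a +ℕ ∣ B ∣) % n ≡ j % n

  SpinChain : ℕ → Necklace n → Set
  SpinChain d []       = ⊤
  SpinChain d (x ∷ xs) = SpinStep (proj₂ x) (proj₁ x) (headLabel d xs) × SpinChain d xs

  spin⇒spinChain : ∀ (N : Necklace n) → All SpinCond (withNext N) → SpinChain (headLabel 0 N) N
  spin⇒spinChain []      _ = tt
  spin⇒spinChain (x ∷ N) h = go x N h
    where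
    go : ∀ y ys → All SpinCond (zip (y ∷ ys) (ys ++ x ∷ [])) → SpinChain (proj₂ x) (y ∷ ys)
    go y []       (p ∷ []) = p , tt
    go y (z ∷ zs) (p ∷ ps) = p , go z zs ps

  spinChain⇒spin : ∀ (N : Necklace n) → SpinChain (headLabel 0 N) N → All SpinCond (withNext N)
  spinChain⇒spin []      _ = []
  spinChain⇒spin (x ∷ N) h = go x N h
    where
    go : ∀ y ys → SpinChain (proj₂ x) (y ∷ ys) → All SpinCond (zip (y ∷ ys) (ys ++ x ∷ []))
    go y []       (p , tt) = p ∷ []
    go y (z ∷ zs) (p , ps) = p ∷ go z zs ps

  headLabel-++ : ∀ d (xs ys : Necklace n) → headLabel d (xs ++ ys) ≡ headLabel (headLabel d ys) xs
  headLabel-++ d []       ys = refl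
  headLabel-++ d (x ∷ xs) ys = refl

  spinChain-++⁻ : ∀ d (xs ys : Necklace n) → SpinChain d (xs ++ ys) →
                  SpinChain (headLabel d ys) xs × SpinChain d ys
  spinChain-++⁻ d []       ys h       = tt , h
  spinChain-++⁻ d (x ∷ xs) ys (p , h) =
    (subst (SpinStep (proj₂ x) (proj₁ x)) (headLabel-++ d xs ys) p , proj₁ ih) , proj₂ ih
    where ih = spinChain-++⁻ d xs ys h

  spinChain-++⁺ : ∀ d (xs ys : Necklace n) → SpinChain (headLabel d ys) xs → SpinChain d ys →
                  SpinChain d (xs ++ ys)
  spinChain-++⁺ d []       ys _        h  = h
  spinChain-++⁺ d (x ∷ xs) ys (p , hx) hy =
    subst (SpinStep (proj₂ x) (proj₁ x)) (sym (headLabel-++ d xs ys)) p , spinChain-++⁺ d xs ys hx hy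

  spinChain-rotate : ∀ (ys : Necklace n) X zs → SpinChain (headLabel 0 (ys ++ X ∷ zs)) (ys ++ X ∷ zs) →
                     SpinChain (proj₂ X) (X ∷ zs ++ ys)
  spinChain-rotate ys X zs h =
    subst (SpinStep (proj₂ X) (proj₁ X)) step-label step ,
    spinChain-++⁺ (proj₂ X) zs ys (subst (λ d → SpinChain d zs) first-label chain-zs) chain-ys
    where
    first-label : headLabel 0 (ys ++ X ∷ zs) ≡ headLabel (proj₂ X) ys
    first-label = headLabel-++ 0 ys (X ∷ zs)
    split-chain = spinChain-++⁻ (headLabel 0 (ys ++ X ∷ zs)) ys (X ∷ zs) h
    chain-ys = proj₁ split-chain
    step     = proj₁ (proj₂ split-chain)
    chain-zs = proj₂ (proj₂ split-chain)
    step-label : headLabel (headLabel 0 (ys ++ X ∷ zs)) zs ≡ headLabel (proj₂ X) (zs ++ ys)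
    step-label = trans (cong (λ d → headLabel d zs) first-label) (sym (headLabel-++ (proj₂ X) zs ys))

  +-congʳ-mod : ∀ a b s → a % n ≡ b % n → (a +ℕ s) % n ≡ (b +ℕ s) % n
  +-congʳ-mod a b s e = begin
    (a +ℕ s) % n ≡⟨ %-distribˡ-+ a s n ⟩
    (a % n +ℕ s % n) % n ≡⟨ cong (λ z → (z +ℕ s % n) % n) e ⟩
    (b % n +ℕ s % n) % n ≡⟨ sym (%-distribˡ-+ b s n) ⟩
    (b +ℕ s) % n ∎
    where open ≡-Reasoning

  nextLabel≡mod : ∀ m → 1 ≤ℕ m → suc ((m ∸ 1) % n) % n ≡ m % n
  nextLabel≡mod (suc k) _ = begin
    (1 +ℕ k % n) % n ≡⟨ %-distribˡ-+ 1 (k % n) n ⟩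
    (1 % n +ℕ k % n % n) % n ≡⟨ cong (λ z → (1 % n +ℕ z) % n) (m%n%n≡m%n k n) ⟩
    (1 % n +ℕ k % n) % n ≡⟨ sym (%-distribˡ-+ 1 k n) ⟩
    (1 +ℕ k) % n ∎
    where open ≡-Reasoning

  nextLabel-noWrap : ∀ m → 1 ≤ℕ m → m ≤ℕ n → suc ((m ∸ 1) % n) ≡ m
  nextLabel-noWrap (suc k) _ le = cong suc (m<n⇒m%n≡m le)

  nextLabel-wrap : ∀ m → n <ℕ m → m ≤ℕ n +ℕ n → suc ((m ∸ 1) % n) ≡ m ∸ n
  nextLabel-wrap (suc m') (s≤s n≤m') le' = begin
    suc (m' % n) ≡⟨ cong (λ z → suc (z % n)) (sym (ℕP.m∸n+n≡m n≤m')) ⟩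
    suc ((m' ∸ n +ℕ n) % n) ≡⟨ cong suc ([m+n]%n≡m%n (m' ∸ n) n) ⟩
    suc ((m' ∸ n) % n) ≡⟨ cong suc (m<n⇒m%n≡m k<n) ⟩
    suc (m' ∸ n) ≡⟨ sym (ℕP.+-∸-assoc 1 n≤m') ⟩
    suc m' ∸ n ∎
    where
    open ≡-Reasoning
    k<n : m' ∸ n <ℕ n
    k<n = ℕP.+-cancelʳ-< n (m' ∸ n) n (subst (_<ℕ n +ℕ n) (sym (ℕP.m∸n+n≡m n≤m')) le')

  nextLabel-inRange : ∀ a (P : Subset n) → 1 ≤ℕ nextLabel a P × nextLabel a P ≤ℕ n
  nextLabel-inRange a P = s≤s z≤n , m%n<n (a +ℕ ∣ P ∣ ∸ 1) n

  label-unique : ∀ j j' → 1 ≤ℕ j → j ≤ℕ n → 1 ≤ℕ j' → j' ≤ℕ n → j % n ≡ j' % n → j ≡ j'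
  label-unique j j' a b c d e with ℕP.m≤n⇒m<n∨m≡n b | ℕP.m≤n⇒m<n∨m≡n d
  ... | inj₁ lt | inj₁ lt' = trans (sym (m<n⇒m%n≡m lt)) (trans e (m<n⇒m%n≡m lt'))
  ... | inj₂ refl | inj₂ refl = refl
  ... | inj₁ lt | inj₂ refl = ⊥-elim (ℕP.<⇒≱ a (ℕP.≤-reflexive (trans (sym (m<n⇒m%n≡m lt)) (trans e (n%n≡0 n)))))
  ... | inj₂ refl | inj₁ lt' = ⊥-elim (ℕP.<⇒≱ c (ℕP.≤-reflexive (trans (sym (m<n⇒m%n≡m lt')) (trans (sym e) (n%n≡0 n)))))

  nextLabel-unique : ∀ a B j → SpinStep a B j → 1 ≤ℕ a +ℕ ∣ B ∣ → 1 ≤ℕ j → j ≤ℕ n → j ≡ nextLabel a B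
  nextLabel-unique a B j sc ge j1 jn = label-unique j (nextLabel a B) j1 jn (proj₁ (nextLabel-inRange a B)) (proj₂ (nextLabel-inRange a B))
    (trans (sym sc) (sym (nextLabel≡mod (a +ℕ ∣ B ∣) ge)))

module Refinement {n : ℕ} .{{_ : NonZero n}} where
  open Labels {n}

  lastLabel : ℕ → List (Subset n) → ℕ
  lastLabel a [] = a
  lastLabel a (P ∷ Ps) = lastLabel (nextLabel a P) Ps

  relabel-++ : ∀ a (Ps Qs : List (Subset n)) → relabel a (Ps ++ Qs) ≡ relabel a Ps ++ relabel (lastLabel a Ps) Qs
  relabel-++ a [] Qs = refl
  relabel-++ a (P ∷ Ps) Qs = cong ((P , a) ∷_) (relabel-++ (nextLabel a P) Ps Qs)

  blocks-relabel : ∀ a (Ps : List (Subset n)) → blocks (relabel a Ps) ≡ Ps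
  blocks-relabel a [] = refl
  blocks-relabel a (P ∷ Ps) = cong (P ∷_) (blocks-relabel (nextLabel a P) Ps)

  relabel-noWrap : ∀ a (Ps : List (Subset n)) → 1 ≤ℕ a → a +ℕ sizes Ps ≤ℕ n →
                   lastLabel a Ps ≡ a +ℕ sizes Ps × LabelsBetween a (a +ℕ sizes Ps) (relabel a Ps)
  relabel-noWrap a []       _   _       = sym (ℕP.+-identityʳ a) , []
  relabel-noWrap a (P ∷ Ps) 1≤a a+s≤n =
    trans (proj₁ ih) assoc , (ℕP.≤-refl , ℕP.m≤m+n a _) ∷ All.map (λ {e} → widen {e}) (proj₂ ih)
    where
    assoc : a +ℕ ∣ P ∣ +ℕ sizes Ps ≡ a +ℕ sizes (P ∷ Ps)
    assoc = ℕP.+-assoc a ∣ P ∣ (sizes Ps)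
    1≤a+∣P∣ : 1 ≤ℕ a +ℕ ∣ P ∣
    1≤a+∣P∣ = ℕP.≤-trans 1≤a (ℕP.m≤m+n a _)
    next≡a+∣P∣ : nextLabel a P ≡ a +ℕ ∣ P ∣
    next≡a+∣P∣ = nextLabel-noWrap (a +ℕ ∣ P ∣) 1≤a+∣P∣
                   (ℕP.≤-trans (subst (a +ℕ ∣ P ∣ ≤ℕ_) assoc (ℕP.m≤m+n _ (sizes Ps))) a+s≤n)
    ih : lastLabel (nextLabel a P) Ps ≡ a +ℕ ∣ P ∣ +ℕ sizes Ps ×
         LabelsBetween (a +ℕ ∣ P ∣) (a +ℕ ∣ P ∣ +ℕ sizes Ps) (relabel (nextLabel a P) Ps)
    ih rewrite next≡a+∣P∣ = relabel-noWrap (a +ℕ ∣ P ∣) Ps 1≤a+∣P∣ (subst (_≤ℕ n) (sym assoc) a+s≤n)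
    widen : ∀ {e : Subset n × ℕ} → a +ℕ ∣ P ∣ ≤ℕ proj₂ e × proj₂ e ≤ℕ a +ℕ ∣ P ∣ +ℕ sizes Ps →
            a ≤ℕ proj₂ e × proj₂ e ≤ℕ a +ℕ sizes (P ∷ Ps)
    widen {e} (lo , hi) = ℕP.≤-trans (ℕP.m≤m+n a ∣ P ∣) lo , subst (proj₂ e ≤ℕ_) assoc hi

  relabel-inRange : ∀ a (Ps : List (Subset n)) → 1 ≤ℕ a → a ≤ℕ n → All LabelInRange (relabel a Ps)
  relabel-inRange a [] a1 an = []
  relabel-inRange a (P ∷ Ps) a1 an =
    (a1 , an) ∷ relabel-inRange (nextLabel a P) Ps (proj₁ (nextLabel-inRange a P)) (proj₂ (nextLabel-inRange a P))

  relabel-spinChain : ∀ a d (Ps : List (Subset n)) → All (λ P → 1 ≤ℕ ∣ P ∣) Ps → (a +ℕ sizes Ps) % n ≡ d % n →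
                      SpinChain d (relabel a Ps)
  relabel-spinChain a d [] _ _ = tt
  relabel-spinChain a d (P ∷ []) (p ∷ []) e = trans (cong (λ z → (a +ℕ z) % n) (sym (ℕP.+-identityʳ ∣ P ∣))) e , tt
  relabel-spinChain a d (P ∷ Q ∷ Ps) (p ∷ ps) e =
    sym (nextLabel≡mod (a +ℕ ∣ P ∣) (ℕP.≤-trans p (ℕP.m≤n+m _ a))) ,
    relabel-spinChain (nextLabel a P) d (Q ∷ Ps) ps
      (trans (+-congʳ-mod (nextLabel a P) (a +ℕ ∣ P ∣) (sizes (Q ∷ Ps)) (nextLabel≡mod (a +ℕ ∣ P ∣) (ℕP.≤-trans p (ℕP.m≤n+m _ a))))
        (trans (cong (_% n) (ℕP.+-assoc a ∣ P ∣ (sizes (Q ∷ Ps)))) e))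

  refine-++ : ∀ (S : List (Subset n)) (xs ys : Necklace n) → refine S (xs ++ ys) ≡ refine S xs ++ refine S ys
  refine-++ S [] ys = refl
  refine-++ S (x ∷ xs) ys = trans (cong (relabel (proj₂ x) (pieces S (proj₁ x)) ++_) (refine-++ S xs ys))
                                  (sym (++-assoc (relabel (proj₂ x) (pieces S (proj₁ x))) (refine S xs) (refine S ys)))

  module _ (S : List (Subset n)) (S-partition : ∀ i → countBlocks i S ≡ 1) where

    pieces-1≤size : ∀ B → All (λ P → 1 ≤ℕ ∣ P ∣) (pieces S B)
    pieces-1≤size B = All.map nonempty⇒1≤∣p∣ (all-nonempty-pieces S B)

    headLabel-refine : ∀ d (N : Necklace n) → All (Nonempty ∘ proj₁) N → headLabel d (refine S N) ≡ headLabel d N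
    headLabel-refine d [] _ = refl
    headLabel-refine d ((B , a) ∷ N) (ne ∷ _) with pieces-nonempty S S-partition B ne
    ... | P , Ps , eq rewrite eq = refl

    headLabel-refine-++ : ∀ d (N : Necklace n) X → All (Nonempty ∘ proj₁) N →
                   headLabel d (refine S N ++ X) ≡ headLabel (headLabel d X) N
    headLabel-refine-++ d N X ne = trans (headLabel-++ d (refine S N) X) (headLabel-refine (headLabel d X) N ne)

    refine-spinChain : ∀ d (N : Necklace n) → All (Nonempty ∘ proj₁) N → SpinChain d N → SpinChain d (refine S N)
    refine-spinChain d [] _ _ = tt
    refine-spinChain d ((B , a) ∷ N) (ne ∷ nes) (sc , ch) =
      spinChain-++⁺ d (relabel a (pieces S B)) (refine S N)
        (relabel-spinChain a _ (pieces S B) (pieces-1≤size B)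
          (trans (cong (λ z → (a +ℕ z) % n) (sizes-pieces S S-partition B))
                 (trans sc (cong (_% n) (sym (headLabel-refine d N nes))))))
        (refine-spinChain d N nes ch)

    countBlocks-refine : ∀ i (N : Necklace n) → countBlocks i (blocks (refine S N)) ≡ countBlocks i (blocks N)
    countBlocks-refine i [] = refl
    countBlocks-refine i ((B , a) ∷ N) = begin
      countBlocks i (blocks (relabel a (pieces S B) ++ refine S N))
        ≡⟨ cong (countBlocks i) (map-++ proj₁ (relabel a (pieces S B)) (refine S N)) ⟩
      countBlocks i (blocks (relabel a (pieces S B)) ++ blocks (refine S N))
        ≡⟨ countBlocks-++ i (blocks (relabel a (pieces S B))) (blocks (refine S N)) ⟩
      countBlocks i (blocks (relabel a (pieces S B))) +ℕ countBlocks i (blocks (refine S N))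
        ≡⟨ cong₂ _+ℕ_ (trans (cong (countBlocks i) (blocks-relabel a (pieces S B))) (countBlocks-pieces S S-partition i B)) (countBlocks-refine i N) ⟩
      [ mem i B ]b +ℕ countBlocks i (blocks N)
        ≡⟨ sym (countBlocks-∷ i B (blocks N)) ⟩
      countBlocks i (B ∷ blocks N) ∎
      where open ≡-Reasoning

    nonempty-refine : ∀ (N : Necklace n) → All Nonempty (blocks (refine S N))
    nonempty-refine [] = []
    nonempty-refine ((B , a) ∷ N) = subst (All Nonempty) (sym (map-++ proj₁ (relabel a (pieces S B)) (refine S N)))
      (AllP.++⁺ (subst (All Nonempty) (sym (blocks-relabel a (pieces S B))) (all-nonempty-pieces S B)) (nonempty-refine N))

    inRange-refine : ∀ (N : Necklace n) → All LabelInRange N → All LabelInRange (refine S N)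
    inRange-refine [] _ = []
    inRange-refine ((B , a) ∷ N) ((a1 , an) ∷ rs) = AllP.++⁺ (relabel-inRange a (pieces S B) a1 an) (inRange-refine N rs)

  refine-isSpinNecklace : ∀ (N : Necklace n) (S : List (Subset n)) → IsSpinNecklace N → IsComposition S → IsSpinNecklace (refine S N)
  refine-isSpinNecklace N S ((neN , cbN) , rN , spN) (neS , cbS) =
    (nonempty-refine S cbS N , λ i → trans (countBlocks-refine S cbS i N) (cbN i)) ,
    inRange-refine S cbS N rN ,
    spinChain⇒spin (refine S N) (subst (λ d → SpinChain d (refine S N)) (sym (headLabel-refine S cbS 0 N neN'))
      (refine-spinChain S cbS (headLabel 0 N) N neN' (spin⇒spinChain N spN)))
    where
    neN' : All (Nonempty ∘ proj₁) N
    neN' = AllP.map⁻ neN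

record OverflowSplit {A : Set} (f : A → ℕ) (n a : ℕ) (xs : List A) : Set where
  field
    before    : List A
    piece     : A
    after     : List A
    split     : xs ≡ before ++ piece ∷ after
    fits      : a +ℕ sum (map f before) ≤ℕ n
    overflows : n <ℕ a +ℕ sum (map f before) +ℕ f piece

overflowSplit : ∀ {A : Set} (f : A → ℕ) n a (xs : List A) → a ≤ℕ n → n <ℕ a +ℕ sum (map f xs) →
  OverflowSplit f n a xs
overflowSplit f n a [] a≤n n<a+0 = ⊥-elim (ℕP.<⇒≱ n<a+0 (subst (_≤ℕ n) (sym (ℕP.+-identityʳ a)) a≤n))
overflowSplit f n a (x ∷ xs) a≤n n<total with n ℕP.<? a +ℕ f x
... | yes n<a+fx = record
  { before = [] ; piece = x ; after = xs ; split = refl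
  ; fits = subst (_≤ℕ n) (sym (ℕP.+-identityʳ a)) a≤n
  ; overflows = subst (λ z → n <ℕ z +ℕ f x) (sym (ℕP.+-identityʳ a)) n<a+fx }
... | no n≮a+fx = record
  { before = x ∷ before ; piece = piece ; after = after ; split = cong (x ∷_) split
  ; fits = subst (_≤ℕ n) (ℕP.+-assoc a (f x) _) fits
  ; overflows = subst (λ z → n <ℕ z +ℕ f piece) (ℕP.+-assoc a (f x) _) overflows }
  where
  open OverflowSplit (overflowSplit f n (a +ℕ f x) xs (ℕP.≮⇒≥ n≮a+fx)
                       (subst (n <ℕ_) (sym (ℕP.+-assoc a (f x) _)) n<total))

headLabel-inRange : ∀ {n} d (M : Necklace n) → All LabelInRange M → 1 ≤ℕ d → d ≤ℕ n →
                    1 ≤ℕ headLabel d M × headLabel d M ≤ℕ n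
headLabel-inRange d []            _       1≤d d≤n = 1≤d , d≤n
headLabel-inRange d ((B , a) ∷ M) (r ∷ _) _   _   = r

-- Along the arc from the outgoing edge of the clasp to its incoming edge the labels do not wrap around.
module _ {n : ℕ} .{{_ : NonZero n}} (S : List (Subset n)) (S-partition : ∀ i → countBlocks i S ≡ 1) where
  open Labels {n}
  open Refinement {n}

  refine-labelsBetween : ∀ d (M : Necklace n) → SpinChain d M → All LabelInRange M → All (Nonempty ∘ proj₁) M →
                         1 ≤ℕ d → d ≤ℕ n → headLabel d M +ℕ sizes (blocks M) ≡ d →
                         LabelsBetween (headLabel d M) d (refine S M)
  refine-labelsBetween d []            _        _                 _          _   _   _  = []
  refine-labelsBetween d ((B , a) ∷ M) (sc , ch) ((1≤a , _) ∷ rs) (ne ∷ nes) 1≤d d≤n eq =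
    AllP.++⁺ (All.map (λ {x} → lower {x}) pieces-labels) (All.map (λ {x} → upper {x}) rest-labels)
    where
    a' : ℕ
    a' = headLabel d M
    sizes-B : sizes (pieces S B) ≡ ∣ B ∣
    sizes-B = sizes-pieces S S-partition B
    a+∣B∣+rest≡d : a +ℕ ∣ B ∣ +ℕ sizes (blocks M) ≡ d
    a+∣B∣+rest≡d = trans (ℕP.+-assoc a ∣ B ∣ _) eq
    a+∣B∣≤d : a +ℕ ∣ B ∣ ≤ℕ d
    a+∣B∣≤d = subst (a +ℕ ∣ B ∣ ≤ℕ_) a+∣B∣+rest≡d (ℕP.m≤m+n _ _)
    1≤a+∣B∣ : 1 ≤ℕ a +ℕ ∣ B ∣
    1≤a+∣B∣ = ℕP.≤-trans 1≤a (ℕP.m≤m+n a _)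
    a'≡a+∣B∣ : a' ≡ a +ℕ ∣ B ∣
    a'≡a+∣B∣ = trans (nextLabel-unique a B a' sc 1≤a+∣B∣ (proj₁ a'-inRange) (proj₂ a'-inRange))
                     (nextLabel-noWrap (a +ℕ ∣ B ∣) 1≤a+∣B∣ (ℕP.≤-trans a+∣B∣≤d d≤n))
      where a'-inRange = headLabel-inRange d M rs 1≤d d≤n
    pieces-labels : LabelsBetween a (a +ℕ sizes (pieces S B)) (relabel a (pieces S B))
    pieces-labels = proj₂ (relabel-noWrap a (pieces S B) 1≤a
                             (subst (λ z → a +ℕ z ≤ℕ n) (sym sizes-B) (ℕP.≤-trans a+∣B∣≤d d≤n)))
    rest-labels : LabelsBetween a' d (refine S M)
    rest-labels = refine-labelsBetween d M ch rs nes 1≤d d≤n (trans (cong (_+ℕ sizes (blocks M)) a'≡a+∣B∣) a+∣B∣+rest≡d)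
    lower : ∀ {x : Subset n × ℕ} → a ≤ℕ proj₂ x × proj₂ x ≤ℕ a +ℕ sizes (pieces S B) → a ≤ℕ proj₂ x × proj₂ x ≤ℕ d
    lower (p , q) = p , ℕP.≤-trans q (subst (λ z → a +ℕ z ≤ℕ d) (sym sizes-B) a+∣B∣≤d)
    upper : ∀ {x : Subset n × ℕ} → a' ≤ℕ proj₂ x × proj₂ x ≤ℕ d → a ≤ℕ proj₂ x × proj₂ x ≤ℕ d
    upper (p , q) = ℕP.≤-trans (subst (a ≤ℕ_) (sym a'≡a+∣B∣) (ℕP.m≤m+n a _)) p , q

unionAll : ∀ {n} → List (Subset n) → Subset n → Subset n
unionAll [] X = X
unionAll (P ∷ Ps) X = P ∪ unionAll Ps X

mem-unionAll-inSome : ∀ {n} (i : Fin n) Ps X → InSome i Ps → mem i (unionAll Ps X) ≡ true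
mem-unionAll-inSome i (P ∷ Ps) X (here e) = trans (mem-∪ i P (unionAll Ps X)) (cong (_∨ mem i (unionAll Ps X)) e)
mem-unionAll-inSome i (P ∷ Ps) X (there a) =
  trans (mem-∪ i P (unionAll Ps X)) (trans (cong (mem i P ∨_) (mem-unionAll-inSome i Ps X a)) (∨-zeroʳ _))

mem-unionAll-last : ∀ {n} (i : Fin n) Ps X → mem i X ≡ true → mem i (unionAll Ps X) ≡ true
mem-unionAll-last i [] X e = e
mem-unionAll-last i (P ∷ Ps) X e =
  trans (mem-∪ i P (unionAll Ps X)) (trans (cong (mem i P ∨_) (mem-unionAll-last i Ps X e)) (∨-zeroʳ _))

mem-unionAll-none : ∀ {n} (i : Fin n) Ps X → All (λ P → mem i P ≡ false) Ps → mem i X ≡ false → mem i (unionAll Ps X) ≡ false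
mem-unionAll-none i [] X _ e = e
mem-unionAll-none i (P ∷ Ps) X (p ∷ ps) e = trans (mem-∪ i P (unionAll Ps X)) (cong₂ _∨_ p (mem-unionAll-none i Ps X ps e))

card-∪-disjoint : ∀ {n} (A B : Subset n) → (∀ i → mem i A ≡ true → mem i B ≡ true → ⊥) → card (A ∪ B) ≡ card A +ℕ card B
card-∪-disjoint A B d = trans (∑ℕ.sum-cong-≗ λ i → go i (mem i A) (mem i B) refl refl) (∑ℕ.∑-distrib-+ (λ i → [ mem i A ]b) (λ i → [ mem i B ]b))
  where
  go : ∀ i a b → mem i A ≡ a → mem i B ≡ b → [ mem i (A ∪ B) ]b ≡ [ mem i A ]b +ℕ [ mem i B ]b
  go i true true ea eb = ⊥-elim (d i ea eb)
  go i true false ea eb rewrite mem-∪ i A B | ea | eb = refl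
  go i false true ea eb rewrite mem-∪ i A B | ea | eb = refl
  go i false false ea eb rewrite mem-∪ i A B | ea | eb = refl

card-unionAll : ∀ {n} (Ps : List (Subset n)) X → (∀ i → countBlocks i (Ps List.++ X ∷ []) ≤ℕ 1) →
  card (unionAll Ps X) ≡ sizes Ps +ℕ card X
card-unionAll [] X h = refl
card-unionAll (P ∷ Ps) X h = begin
  card (P ∪ unionAll Ps X) ≡⟨ card-∪-disjoint P (unionAll Ps X) d ⟩
  card P +ℕ card (unionAll Ps X) ≡⟨ cong₂ _+ℕ_ (sym (∣p∣≡card P)) (card-unionAll Ps X h') ⟩
  ∣ P ∣ +ℕ (sizes Ps +ℕ card X) ≡⟨ sym (ℕP.+-assoc ∣ P ∣ (sizes Ps) (card X)) ⟩
  sizes (P ∷ Ps) +ℕ card X ∎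
  where
  open ≡-Reasoning
  h' : ∀ i → countBlocks i (Ps ++ X ∷ []) ≤ℕ 1
  h' i = ℕP.≤-trans (ℕP.m≤n+m _ [ mem i P ]b) (subst (_≤ℕ 1) (countBlocks-∷ i P (Ps ++ X ∷ [])) (h i))
  d : ∀ i → mem i P ≡ true → mem i (unionAll Ps X) ≡ true → ⊥
  d i eP eU = ℕP.<⇒≱ (s≤s (cbpos Ps eU)) (subst (_≤ℕ 1) (trans (countBlocks-∷ i P (Ps ++ X ∷ [])) (cong (λ b → [ b ]b +ℕ _) eP)) (h i))
    where
    cbpos : ∀ Qs → mem i (unionAll Qs X) ≡ true → 1 ≤ℕ countBlocks i (Qs ++ X ∷ [])
    cbpos [] e = subst (1 ≤ℕ_) (sym (trans (countBlocks-∷ i X []) (cong (λ b → [ b ]b +ℕ 0) e))) (s≤s z≤n)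
    cbpos (Q ∷ Qs) e with mem i Q in eQ
    ... | true = subst (1 ≤ℕ_) (sym (trans (countBlocks-∷ i Q (Qs ++ X ∷ [])) (cong (λ b → [ b ]b +ℕ _) eQ))) (s≤s z≤n)
    ... | false = subst (1 ≤ℕ_) (sym (trans (countBlocks-∷ i Q (Qs ++ X ∷ [])) (cong (λ b → [ b ]b +ℕ _) eQ)))
                    (cbpos Qs (trans (sym (trans (mem-∪ i Q (unionAll Qs X)) (cong (_∨ mem i (unionAll Qs X)) eQ))) e))

[_]ℚ : Bool → ℚ
[ true ]ℚ  = 1ℚ
[ false ]ℚ = 0ℚ

positiveOr1 : ℚ → ℚ
positiveOr1 z with 0ℚ ℚP.<? z
... | yes _ = z
... | no  _ = 1ℚ

positiveOr1-positive : ∀ z → 0ℚ < positiveOr1 z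
positiveOr1-positive z with 0ℚ ℚP.<? z
... | yes 0<z = 0<z
... | no  _   = ℚP.positive⁻¹ 1ℚ

positiveOr1-id : ∀ z → 0ℚ < z → positiveOr1 z ≡ z
positiveOr1-id z 0<z with 0ℚ ℚP.<? z
... | yes _   = refl
... | no  0≮z = ⊥-elim (0≮z 0<z)

pairwise : ∀ {A : Set} → (A → A → ℚ) → List A → List ℚ
pairwise f xs = List.cartesianProductWith f xs xs

∈-pairwise : ∀ {A : Set} (f : A → A → ℚ) {xs a b} → a ∈ₗ xs → b ∈ₗ xs → f a b ∈ₗ pairwise f xs
∈-pairwise f = ∈-cartesianProductWith⁺ f

-- For y, v ∈ ℚⁿ, the levels are the numbers y k and y k + 1 and the slopes are the numbers v k.
-- A small ε makes b + t u with 0 < t < ε order (level, slope) pairs lexicographically.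
module Perturbation {n : ℕ} (y v : Point n) where

  level : Fin n × Bool → ℚ
  level (k , m) = y k + [ m ]ℚ

  levelIndices : List (Fin n × Bool)
  levelIndices = List.cartesianProduct (List.allFin n) (true ∷ false ∷ [])

  ∈-levelIndices : ∀ p → p ∈ₗ levelIndices
  ∈-levelIndices (k , m) = ∈-cartesianProduct⁺ (∈-allFin k) (m∈ m)
    where
    m∈ : ∀ m → m ∈ₗ (true ∷ false ∷ [])
    m∈ true  = here refl
    m∈ false = there (here refl)

  IsLevel IsSlope : ℚ → Set
  IsLevel b = Σ (Fin n × Bool) λ p → b ≡ level p
  IsSlope u = Σ (Fin n) λ k → u ≡ v k

  gaps : List ℚ
  gaps = map positiveOr1 (pairwise (λ p p' → level p' - level p) levelIndices)

  spreads : List ℚ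
  spreads = pairwise (λ k k' → v k - v k') (List.allFin n)

  minGap : ℚ
  minGap = ℚExtrema.min 1ℚ gaps

  maxSpread : ℚ
  maxSpread = ℚExtrema.max 0ℚ spreads

  minGap-positive : 0ℚ < minGap
  minGap-positive = ℚExtrema.argmin-all id {1ℚ} {gaps} {P = 0ℚ <_} (ℚP.positive⁻¹ 1ℚ)
                      (AllP.map⁺ (All.universal positiveOr1-positive _))

  minGap≤gap : ∀ {b b'} → IsLevel b → IsLevel b' → b < b' → minGap ≤ b' - b
  minGap≤gap (p , refl) (p' , refl) b<b' =
    subst (minGap ≤_) (positiveOr1-id (level p' - level p) 0<gap)
      (All.lookup (ℚExtrema.min≤xs 1ℚ gaps)
        (∈-map⁺ positiveOr1 (∈-pairwise _ (∈-levelIndices p) (∈-levelIndices p'))))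
    where
    0<gap : 0ℚ < level p' - level p
    0<gap = subst (_< level p' - level p) (ℚP.+-inverseʳ (level p)) (ℚP.+-monoˡ-< (ℚ.- level p) b<b')

  spread≤maxSpread : ∀ {u u'} → IsSlope u → IsSlope u' → u - u' ≤ maxSpread
  spread≤maxSpread (k , refl) (k' , refl) =
    All.lookup (ℚExtrema.xs≤max 0ℚ spreads) (∈-pairwise _ (∈-allFin k) (∈-allFin k'))

  spread+1 : ℚ
  spread+1 = maxSpread + 1ℚ

  spread<spread+1 : maxSpread < spread+1
  spread<spread+1 = subst (_< spread+1) (ℚP.+-identityʳ maxSpread) (ℚP.+-monoʳ-< maxSpread (ℚP.positive⁻¹ 1ℚ))

  instance
    spread+1-positive : Positive spread+1
    spread+1-positive = positive (ℚP.≤-<-trans (ℚExtrema.⊥≤max 0ℚ spreads) spread<spread+1)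
    spread+1-nonZero : ℚ.NonZero spread+1
    spread+1-nonZero = ℚP.pos⇒nonZero spread+1

  ε : ℚ
  ε = minGap * 1/ spread+1

  ε-positive : 0ℚ < ε
  ε-positive = ℚP.positive⁻¹ ε {{ℚP.pos*pos⇒pos minGap {{positive minGap-positive}} (1/ spread+1) {{ℚP.1/pos⇒pos spread+1}}}}

  ε*spread+1 : ε * spread+1 ≡ minGap
  ε*spread+1 = trans (ℚP.*-assoc minGap (1/ spread+1) spread+1)
                     (trans (cong (minGap *_) (ℚP.*-inverseˡ spread+1)) (ℚP.*-identityʳ minGap))

  Lex : ℚ × ℚ → ℚ × ℚ → Set
  Lex (b , u) (b' , u') = (b < b') ⊎ ((b ≡ b') × (u < u'))

  lex⇒perturbed< : ∀ {t b b' u u'} → 0ℚ < t → t < ε → IsLevel b → IsLevel b' → IsSlope u → IsSlope u' →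
                   Lex (b , u) (b' , u') → b + t * u < b' + t * u'
  lex⇒perturbed< {t} {b} {b'} {u} {u'} 0<t t<ε isb isb' isu isu' (inj₁ b<b') = begin-strict
    b + t * u                    ≡⟨ solve 4 (λ b t u u' → b :+ t :* u := (b :+ t :* u') :+ t :* (u :- u')) refl b t u u' ⟩
    (b + t * u') + t * (u - u')  <⟨ ℚP.+-monoʳ-< (b + t * u') small ⟩
    (b + t * u') + (b' - b)      ≡⟨ solve 4 (λ b t u' b' → (b :+ t :* u') :+ (b' :- b) := b' :+ t :* u') refl b t u' b' ⟩
    b' + t * u'                  ∎
    where
    open ℚP.≤-Reasoning
    open +-*-Solver
    instance
      t-nonNegative : NonNegative t
      t-nonNegative = nonNegative (ℚP.<⇒≤ 0<t)
    small : t * (u - u') < b' - b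
    small = begin-strict
      t * (u - u')   ≤⟨ ℚP.*-monoˡ-≤-nonNeg t (spread≤maxSpread isu isu') ⟩
      t * maxSpread  ≤⟨ ℚP.*-monoˡ-≤-nonNeg t (ℚP.<⇒≤ spread<spread+1) ⟩
      t * spread+1   <⟨ ℚP.*-monoˡ-<-pos spread+1 t<ε ⟩
      ε * spread+1   ≡⟨ ε*spread+1 ⟩
      minGap         ≤⟨ minGap≤gap isb isb' b<b' ⟩
      b' - b         ∎
  lex⇒perturbed< {t} {b} 0<t _ _ _ _ _ (inj₂ (refl , u<u')) =
    ℚP.+-monoʳ-< b (ℚP.*-monoʳ-<-pos t {{positive 0<t}} u<u')

/1-+-homo : ∀ a b → (a / 1) + (b / 1) ≡ (a ℤ.+ b) / 1
/1-+-homo a b = ℚP.toℚᵘ-injective (ℚᵘP.≃-trans (ℚP.toℚᵘ-homo-+ (a / 1) (b / 1))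
  (ℚᵘP.≃-trans (ℚᵘP.+-cong (ℚP.toℚᵘ-fromℚᵘ (mkℚᵘ a 0)) (ℚP.toℚᵘ-fromℚᵘ (mkℚᵘ b 0)))
  (ℚᵘP.≃-trans (*≡* e) (ℚᵘP.≃-sym (ℚP.toℚᵘ-fromℚᵘ (mkℚᵘ (a ℤ.+ b) 0))))))
  where
  e : (a ℤ.* ℤ.+ 1 ℤ.+ b ℤ.* ℤ.+ 1) ℤ.* ℤ.+ 1 ≡ (a ℤ.+ b) ℤ.* (ℤ.+ 1 ℤ.* ℤ.+ 1)
  e = trans (ℤP.*-identityʳ _) (trans (cong₂ ℤ._+_ (ℤP.*-identityʳ a) (ℤP.*-identityʳ b)) (sym (ℤP.*-identityʳ _)))

[_]ℤ : Bool → ℤ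
[ true ]ℤ = ℤ.+ 1
[ false ]ℤ = ℤ.+ 0

[]ℤ-difference/1 : ∀ a b → ([ a ]ℤ ℤ.- [ b ]ℤ) / 1 ≡ [ a ]ℚ - [ b ]ℚ
[]ℤ-difference/1 true true = refl
[]ℤ-difference/1 true false = refl
[]ℤ-difference/1 false true = refl
[]ℤ-difference/1 false false = refl

sumℚ-+ : ∀ {n} (f g : Fin n → ℚ) → sumℚ (λ i → f i + g i) ≡ sumℚ f + sumℚ g
sumℚ-+ {zero} f g = refl
sumℚ-+ {suc n} f g = trans (cong (f fzero + g fzero +_) (sumℚ-+ (f ∘ fsuc) (g ∘ fsuc)))
  (solve 4 (λ a b c d → (a :+ b) :+ (c :+ d) := (a :+ c) :+ (b :+ d)) refl (f fzero) (g fzero) (sumℚ (f ∘ fsuc)) (sumℚ (g ∘ fsuc)))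
  where open +-*-Solver

sumℚ-* : ∀ {n} t (f : Fin n → ℚ) → sumℚ (λ i → t * f i) ≡ t * sumℚ f
sumℚ-* {zero} t f = sym (ℚP.*-zeroʳ t)
sumℚ-* {suc n} t f = trans (cong (t * f fzero +_) (sumℚ-* t (f ∘ fsuc))) (sym (ℚP.*-distribˡ-+ t (f fzero) (sumℚ (f ∘ fsuc))))

sumℚ-neg : ∀ {n} (f : Fin n → ℚ) → sumℚ (λ i → ℚ.- f i) ≡ ℚ.- sumℚ f
sumℚ-neg {zero} f = refl
sumℚ-neg {suc n} f = trans (cong (ℚ.- f fzero +_) (sumℚ-neg (f ∘ fsuc))) (sym (ℚP.neg-distrib-+ (f fzero) (sumℚ (f ∘ fsuc))))

sumℚ-cong : ∀ {n} {f g : Fin n → ℚ} → (∀ i → f i ≡ g i) → sumℚ f ≡ sumℚ g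
sumℚ-cong {zero} e = refl
sumℚ-cong {suc n} e = cong₂ _+_ (e fzero) (sumℚ-cong (e ∘ fsuc))

sumℚ-/1 : ∀ {n} (z : Fin n → ℤ) → sumℚ (λ i → z i / 1) ≡ sumℤ z / 1
sumℚ-/1 {zero} z = refl
sumℚ-/1 {suc n} z = trans (cong (z fzero / 1 +_) (sumℚ-/1 (z ∘ fsuc))) (/1-+-homo (z fzero) (sumℤ (z ∘ fsuc)))

sumℤ-+ : ∀ {n} (f g : Fin n → ℤ) → sumℤ (λ i → f i ℤ.+ g i) ≡ sumℤ f ℤ.+ sumℤ g
sumℤ-+ {zero} f g = refl
sumℤ-+ {suc n} f g = trans (cong (λ z → (f fzero ℤ.+ g fzero) ℤ.+ z) (sumℤ-+ (f ∘ fsuc) (g ∘ fsuc)))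
  (solve 4 (λ a b c d → (a :+ b) :+ (c :+ d) := (a :+ c) :+ (b :+ d)) refl (f fzero) (g fzero) (sumℤ (f ∘ fsuc)) (sumℤ (g ∘ fsuc)))
  where open ZS.+-*-Solver

sumℤ-neg : ∀ {n} (f : Fin n → ℤ) → sumℤ (λ i → ℤ.- f i) ≡ ℤ.- sumℤ f
sumℤ-neg {zero} f = refl
sumℤ-neg {suc n} f = trans (cong (λ z → (ℤ.- f fzero) ℤ.+ z) (sumℤ-neg (f ∘ fsuc))) (sym (ℤP.neg-distrib-+ (f fzero) (sumℤ (f ∘ fsuc))))

sumℤ-indicator : ∀ {n} (b : Fin n → Bool) → sumℤ (λ i → [ b i ]ℤ) ≡ ℤ.+ Σf (λ i → [ b i ]b)
sumℤ-indicator {zero} b = refl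
sumℤ-indicator {suc n} b = trans (cong (λ z → [ b fzero ]ℤ ℤ.+ z) (sumℤ-indicator (b ∘ fsuc))) (go (b fzero))
  where
  go : ∀ x → [ x ]ℤ ℤ.+ ℤ.+ Σf (λ i → [ b (fsuc i) ]b) ≡ ℤ.+ ([ x ]b +ℕ Σf (λ i → [ b (fsuc i) ]b))
  go true = refl
  go false = ℤP.+-identityˡ _

InV-+[]· : ∀ {n} (x v : Point n) t → InV x → InV v → InV (x +[ t ]· v)
InV-+[]· x v t x∈V v∈V = begin
  sumℚ (λ i → x i + t * v i)          ≡⟨ sumℚ-+ x (λ i → t * v i) ⟩
  sumℚ x + sumℚ (λ i → t * v i)       ≡⟨ cong₂ _+_ x∈V (sumℚ-* t v) ⟩
  0ℚ + t * sumℚ v                      ≡⟨ cong (λ z → 0ℚ + t * z) v∈V ⟩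
  0ℚ + t * 0ℚ                          ≡⟨ cong (0ℚ +_) (ℚP.*-zeroʳ t) ⟩
  0ℚ                                   ∎
  where open ≡-Reasoning

InV-shift : ∀ {n} (x : Point n) (δ : Fin n → ℤ) → InV x → InL δ → InV (shift x δ)
InV-shift x δ x∈V δ∈L = begin
  sumℚ (λ i → x i + ℚ.- (δ i / 1))      ≡⟨ sumℚ-+ x (λ i → ℚ.- (δ i / 1)) ⟩
  sumℚ x + sumℚ (λ i → ℚ.- (δ i / 1))   ≡⟨ cong₂ _+_ x∈V (sumℚ-neg (λ i → δ i / 1)) ⟩
  0ℚ + ℚ.- sumℚ (λ i → δ i / 1)         ≡⟨ cong (λ z → 0ℚ + ℚ.- z) (trans (sumℚ-/1 δ) (cong (_/ 1) δ∈L)) ⟩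
  0ℚ + ℚ.- (ℤ.+ 0 / 1)                  ≡⟨⟩
  0ℚ                                    ∎
  where open ≡-Reasoning

lastOf : ∀ {A : Set} → A → List A → A
lastOf a [] = a
lastOf a (b ∷ bs) = lastOf b bs

all⇒last : ∀ {A : Set} {P : A → Set} a bs → All P (a ∷ bs) → P (lastOf a bs)
all⇒last a [] (p ∷ []) = p
all⇒last a (b ∷ bs) (_ ∷ ps) = all⇒last b bs ps

lastOr-blocks : ∀ {n} (P : Subset n) (PW : List (Subset n × ℚ)) w → lastOr P (map proj₁ PW) ≡ proj₁ (lastOf (P , w) PW)
lastOr-blocks P [] w = refl
lastOr-blocks P ((Q , u) ∷ PW) w = lastOr-blocks Q PW u

head≤last : ∀ {n} (a : Subset n × ℚ) bs → Increasing (a ∷ bs) → proj₂ a ≤ proj₂ (lastOf a bs)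
head≤last a [] _ = ℚP.≤-refl
head≤last a (b ∷ bs) (h ∷ _) = ℚP.<⇒≤ (all⇒last {P = λ x → proj₂ a < proj₂ x} b bs h)

all≤last : ∀ {n} (a : Subset n × ℚ) bs → Increasing (a ∷ bs) → All (λ b → proj₂ b ≤ proj₂ (lastOf a bs)) (a ∷ bs)
all≤last a [] s = ℚP.≤-refl ∷ []
all≤last a (b ∷ bs) (h ∷ s) = head≤last a (b ∷ bs) (h ∷ s) ∷ all≤last b bs s

lastOr-inSome : ∀ {n} (i : Fin n) P Ps → mem i (lastOr P Ps) ≡ true → InSome i (P ∷ Ps)
lastOr-inSome i P [] e = here e
lastOr-inSome i P (Q ∷ Qs) e = there (lastOr-inSome i Q Qs e)

AllPairs-++⁻ : ∀ {A : Set} {R : A → A → Set} xs {ys} → AllPairs R (xs ++ ys) →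
  AllPairs R xs × AllPairs R ys × All (λ x → All (R x) ys) xs
AllPairs-++⁻ []       p       = [] , p , []
AllPairs-++⁻ (x ∷ xs) (h ∷ t) with AllPairs-++⁻ xs t
... | a , b , c = (AllP.++⁻ˡ xs h ∷ a) , b , (AllP.++⁻ʳ xs h ∷ c)

module ValuedPieces {n : ℕ} (S : List (Subset n)) (S-partition : ∀ i → countBlocks i S ≡ 1)
  (v : Point n) (S-values : Valuation S v) where

  open Valuation S-values

  nonempty?₁ : (e : Subset n × ℚ) → Dec (Nonempty (proj₁ e))
  nonempty?₁ e = nonempty? (proj₁ e)

  restrict : Subset n → List (Subset n × ℚ) → List (Subset n × ℚ)
  restrict B = map (λ e → (B ∩ proj₁ e , proj₂ e))

  valuedPieces : Subset n → List (Subset n × ℚ)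
  valuedPieces B = filter nonempty?₁ (restrict B PW)

  blocks-valuedPieces : ∀ B → map proj₁ (valuedPieces B) ≡ pieces S B
  blocks-valuedPieces B = trans (map-filter (restrict B PW))
    (cong (filter nonempty?) (trans (map-restrict PW) (cong (map (B ∩_)) blocksEq)))
    where
    map-filter : ∀ xs → map proj₁ (filter nonempty?₁ xs) ≡ filter nonempty? (map proj₁ xs)
    map-filter [] = refl
    map-filter (x ∷ xs) with nonempty? (proj₁ x)
    ... | yes _ = cong (proj₁ x ∷_) (map-filter xs)
    ... | no  _ = map-filter xs
    map-restrict : ∀ xs → map proj₁ (restrict B xs) ≡ map (B ∩_) (map proj₁ xs)
    map-restrict []       = refl
    map-restrict (x ∷ xs) = cong (B ∩ proj₁ x ∷_) (map-restrict xs)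

  PieceOf : Subset n → Subset n × ℚ → Set
  PieceOf B e = ∀ i → mem i (proj₁ e) ≡ true → (v i ≡ proj₂ e) × (mem i B ≡ true)

  valuedPieces-pieceOf : ∀ B → All (PieceOf B) (valuedPieces B)
  valuedPieces-pieceOf B = AllP.filter⁺ nonempty?₁ (go PW vals)
    where
    go : ∀ xs → Takes v xs → All (PieceOf B) (restrict B xs)
    go []       []       = []
    go (x ∷ xs) (h ∷ hs) = piece ∷ go xs hs
      where
      piece : PieceOf B (B ∩ proj₁ x , proj₂ x)
      piece i m with mem i B in eB | mem i (proj₁ x) in eP | trans (sym (mem-∩ i B (proj₁ x))) m
      ... | true | true | _ = h i eP , refl

  valuedPieces-increasing : ∀ B → Increasing (valuedPieces B)
  valuedPieces-increasing B = APP.filter⁺ nonempty?₁ (APP.map⁺ sorted)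

  valuedPieces-nonempty : ∀ B → All (Nonempty ∘ proj₁) (valuedPieces B)
  valuedPieces-nonempty B = AllP.all-filter nonempty?₁ (restrict B PW)

  valuedPieces-cover : ∀ B i → mem i B ≡ true → Any (λ e → mem i (proj₁ e) ≡ true) (valuedPieces B)
  valuedPieces-cover B i i∈B =
    keep (restrict B PW) (go PW (subst (InSome i) (sym blocksEq) (countBlocks≥1⇒inSome i S (ℕP.≤-reflexive (sym (S-partition i))))))
    where
    go : ∀ xs → InSome i (map proj₁ xs) → Any (λ e → mem i (proj₁ e) ≡ true) (restrict B xs)
    go (x ∷ xs) (here e)  = here (trans (mem-∩ i B (proj₁ x)) (cong₂ _∧_ i∈B e))
    go (x ∷ xs) (there a) = there (go xs a)
    keep : ∀ xs → Any (λ e → mem i (proj₁ e) ≡ true) xs → Any (λ e → mem i (proj₁ e) ≡ true) (filter nonempty?₁ xs)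
    keep (x ∷ xs) (here e) with nonempty? (proj₁ x)
    ... | yes _  = here e
    ... | no  ¬ne = ⊥-elim (¬ne (i , mem⇒∈ e))
    keep (x ∷ xs) (there a) with nonempty? (proj₁ x)
    ... | yes _ = there (keep xs a)
    ... | no  _ = keep xs a

module Clasp {n : ℕ} .{{_ : NonZero n}} (N : Necklace n) (spin : IsSpinNecklace N) (s : ClaspSplit N) where

  open Labels {n}
  open ClaspSplit s

  N-nonempty : All Nonempty (blocks N)
  N-nonempty = proj₁ (proj₁ spin)

  N-partition : ∀ i → countBlocks i (blocks N) ≡ 1
  N-partition = proj₂ (proj₁ spin)

  N-inRange : All LabelInRange N
  N-inRange = proj₁ (proj₂ spin)

  N-spin : All SpinCond (withNext N)
  N-spin = proj₂ (proj₂ spin)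

  rest : Necklace n
  rest = zs ++ ys

  split-inRange : All LabelInRange (ys ++ (C , ℓ) ∷ zs)
  split-inRange = subst (All LabelInRange) split N-inRange

  ℓ-inRange : 1 ≤ℕ ℓ × ℓ ≤ℕ n
  ℓ-inRange = All.head (AllP.++⁻ʳ ys split-inRange)

  1≤ℓ : 1 ≤ℕ ℓ
  1≤ℓ = proj₁ ℓ-inRange

  ℓ≤n : ℓ ≤ℕ n
  ℓ≤n = proj₂ ℓ-inRange

  rest-inRange : All LabelInRange rest
  rest-inRange = AllP.++⁺ (All.tail (AllP.++⁻ʳ ys split-inRange)) (AllP.++⁻ˡ ys split-inRange)

  r-inRange : 1 ≤ℕ r × r ≤ℕ n
  r-inRange = headLabel-inRange ℓ rest rest-inRange 1≤ℓ ℓ≤n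

  r≤ℓ : r ≤ℕ ℓ
  r≤ℓ = All.head (AllP.++⁻ʳ ys (subst (All (λ e → r ≤ℕ proj₂ e)) split outMin))

  clasp∷rest-spinChain : SpinChain ℓ ((C , ℓ) ∷ rest)
  clasp∷rest-spinChain = spinChain-rotate ys (C , ℓ) zs (subst (λ L → SpinChain (headLabel 0 L) L) split (spin⇒spinChain N N-spin))

  clasp-spinStep : SpinStep ℓ C r
  clasp-spinStep = proj₁ clasp∷rest-spinChain

  rest-spinChain : SpinChain ℓ rest
  rest-spinChain = proj₂ clasp∷rest-spinChain

  split-nonempty : All (Nonempty ∘ proj₁) (ys ++ (C , ℓ) ∷ zs)
  split-nonempty = subst (All (Nonempty ∘ proj₁)) split (AllP.map⁻ N-nonempty)

  C-nonempty : Nonempty C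
  C-nonempty = All.head (AllP.++⁻ʳ ys split-nonempty)

  rest-nonempty : All (Nonempty ∘ proj₁) rest
  rest-nonempty = AllP.++⁺ (All.tail (AllP.++⁻ʳ ys split-nonempty)) (AllP.++⁻ˡ ys split-nonempty)

  blocks-N : blocks N ≡ blocks ys ++ C ∷ blocks zs
  blocks-N = trans (cong blocks split) (map-++ proj₁ ys ((C , ℓ) ∷ zs))

  blocks-rest : blocks rest ≡ blocks zs ++ blocks ys
  blocks-rest = map-++ proj₁ zs ys

  sizes-N : sizes (blocks N) ≡ n
  sizes-N = trans (sizes≡Σf-countBlocks (blocks N)) (trans (∑ℕ.sum-cong-≗ N-partition) Σf-1)

  C∷rest-partition : ∀ i → [ mem i C ]b +ℕ countBlocks i (blocks rest) ≡ 1
  C∷rest-partition i = begin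
    [ mem i C ]b +ℕ countBlocks i (blocks rest)
      ≡⟨ cong ([ mem i C ]b +ℕ_) (trans (cong (countBlocks i) blocks-rest) (countBlocks-++ i (blocks zs) (blocks ys))) ⟩
    [ mem i C ]b +ℕ (cz +ℕ cy)
      ≡⟨ NS.+-*-Solver.solve 3 (λ a p q → a :+ (p :+ q) := q :+ (a :+ p)) refl [ mem i C ]b cz cy ⟩
    cy +ℕ ([ mem i C ]b +ℕ cz)   ≡⟨ cong (cy +ℕ_) (countBlocks-∷ i C (blocks zs)) ⟨
    cy +ℕ countBlocks i (C ∷ blocks zs)         ≡⟨ countBlocks-++ i (blocks ys) (C ∷ blocks zs) ⟨
    countBlocks i (blocks ys ++ C ∷ blocks zs)  ≡⟨ cong (countBlocks i) blocks-N ⟨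
    countBlocks i (blocks N)                    ≡⟨ N-partition i ⟩
    1                                           ∎
    where
    open ≡-Reasoning
    open NS.+-*-Solver using (_:+_; _:=_)
    cz cy : ℕ
    cz = countBlocks i (blocks zs)
    cy = countBlocks i (blocks ys)

  inRest⇒∉C : ∀ i → InSome i (blocks rest) → mem i C ≡ false
  inRest⇒∉C i i∈rest = [b]≤0⇒false (ℕP.+-cancelʳ-≤ 1 _ 0 (begin
    [ mem i C ]b +ℕ 1
      ≤⟨ ℕP.+-monoʳ-≤ [ mem i C ]b (inSome⇒countBlocks≥1 i (blocks rest) i∈rest) ⟩
    [ mem i C ]b +ℕ countBlocks i (blocks rest)  ≡⟨ C∷rest-partition i ⟩
    1                                            ∎))
    where open ℕP.≤-Reasoning

  ∉C⇒inRest : ∀ i → mem i C ≡ false → InSome i (blocks rest)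
  ∉C⇒inRest i i∉C = countBlocks≥1⇒inSome i (blocks rest)
    (ℕP.≤-reflexive (sym (trans (cong (λ b → [ b ]b +ℕ countBlocks i (blocks rest)) (sym i∉C)) (C∷rest-partition i))))

  ∣C∣+sizes-rest : ∣ C ∣ +ℕ sizes (blocks rest) ≡ n
  ∣C∣+sizes-rest = begin
    ∣ C ∣ +ℕ sizes (blocks rest)
      ≡⟨ cong (∣ C ∣ +ℕ_) (trans (cong sizes blocks-rest) (sizes-++ (blocks zs) (blocks ys))) ⟩
    ∣ C ∣ +ℕ (sizes (blocks zs) +ℕ sizes (blocks ys))
      ≡⟨ NS.+-*-Solver.solve 3 (λ a b c → a :+ (b :+ c) := c :+ (a :+ b)) refl ∣ C ∣ (sizes (blocks zs)) (sizes (blocks ys)) ⟩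
    sizes (blocks ys) +ℕ (∣ C ∣ +ℕ sizes (blocks zs)) ≡⟨ sym (sizes-++ (blocks ys) (C ∷ blocks zs)) ⟩
    sizes (blocks ys ++ C ∷ blocks zs) ≡⟨ cong sizes (sym blocks-N) ⟩
    sizes (blocks N) ≡⟨ sizes-N ⟩
    n ∎
    where
    open ≡-Reasoning
    open NS.+-*-Solver using (_:+_; _:=_)

  1≤∣C∣ : 1 ≤ℕ ∣ C ∣
  1≤∣C∣ = nonempty⇒1≤∣p∣ C-nonempty

  r≡nextLabel : r ≡ nextLabel ℓ C
  r≡nextLabel = nextLabel-unique ℓ C r clasp-spinStep (ℕP.≤-trans 1≤ℓ (ℕP.m≤m+n ℓ _)) (proj₁ r-inRange) (proj₂ r-inRange)

  -- Without wrap-around we would have r = ℓ + |C| > ℓ, contradicting the maximality of ℓ.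
  clasp-wraps : ℓ +ℕ ∣ C ∣ ≡ r +ℕ n
  clasp-wraps with n ℕP.<? ℓ +ℕ ∣ C ∣
  ... | yes lt = sym (trans (cong (_+ℕ n) (trans r≡nextLabel (nextLabel-wrap (ℓ +ℕ ∣ C ∣) lt (ℕP.+-mono-≤ ℓ≤n (∣p∣≤n C)))))
                    (ℕP.m∸n+n≡m (ℕP.<⇒≤ lt)))
  ... | no ¬lt = ⊥-elim (ℕP.<⇒≱ (ℕP.<-≤-trans (ℕP.m<m+n ℓ 1≤∣C∣) (ℕP.≤-reflexive (sym r≡'))) r≤ℓ)
    where
    r≡' : r ≡ ℓ +ℕ ∣ C ∣
    r≡' = trans r≡nextLabel (nextLabel-noWrap (ℓ +ℕ ∣ C ∣) (ℕP.≤-trans 1≤ℓ (ℕP.m≤m+n ℓ _)) (ℕP.≮⇒≥ ¬lt))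

  rest-noWrap : r +ℕ sizes (blocks rest) ≡ ℓ
  rest-noWrap = ℕP.+-cancelʳ-≡ ∣ C ∣ _ _ (begin
    r +ℕ sizes (blocks rest) +ℕ ∣ C ∣ ≡⟨ ℕP.+-assoc r _ _ ⟩
    r +ℕ (sizes (blocks rest) +ℕ ∣ C ∣) ≡⟨ cong (r +ℕ_) (trans (ℕP.+-comm _ ∣ C ∣) ∣C∣+sizes-rest) ⟩
    r +ℕ n ≡⟨ sym clasp-wraps ⟩
    ℓ +ℕ ∣ C ∣ ∎)
    where open ≡-Reasoning

module OldFace {n : ℕ} .{{_ : NonZero n}} (N : Necklace n) (spin : IsSpinNecklace N) (s : ClaspSplit N)
  (y : Point n) (y-inFace : AffFaceCond s y) where

  open ClaspSplit s
  open Clasp N spin s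

  y-ordered : OrderedBy (listed ++ C₁ ∷ []) y
  y-ordered = proj₁ y-inFace

  y-C₁≡y-C₂+1 : ∀ i j → i ∈ C₁ → j ∈ C₂ → y i ≡ y j + 1ℚ
  y-C₁≡y-C₂+1 = proj₁ (proj₂ y-inFace)

  y-L<y-C₂+1 : ¬ Nonempty C₁ → ∀ i j → i ∈ Lblock → j ∈ C₂ → y i < y j + 1ℚ
  y-L<y-C₂+1 = proj₂ (proj₂ y-inFace)

  ∣C₂∣≡r : ∣ C₂ ∣ ≡ r
  ∣C₂∣≡r = ∣largest∣≡r C ℓ≤n clasp-wraps

  C₁-C₂-disjoint : ∀ i → mem i C₁ ≡ true → mem i C₂ ≡ true → ⊥
  C₁-C₂-disjoint = smallest-largest-apart C ℓ≤n clasp-wraps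

  C₁-C₂-cover : ∀ i → mem i C ≡ true → (mem i C₁ ≡ true) ⊎ (mem i C₂ ≡ true)
  C₁-C₂-cover = smallest-largest-split C ℓ≤n clasp-wraps

  C₂-nonempty : Nonempty C₂
  C₂-nonempty = 1≤∣p∣⇒nonempty C₂ (subst (1 ≤ℕ_) (sym ∣C₂∣≡r) (proj₁ r-inRange))

  e₂ : Fin n
  e₂ = witness C₂-nonempty

  c : ℚ
  c = y e₂

  indicator-C₁-C₂ : ∀ a → (mem a C₁ ≡ true → mem a C₂ ≡ true → ⊥) →
                    [ mem a C₂ ]b +ℕ [ mem a C₁ ]b ≤ℕ [ mem a C ]b
  indicator-C₁-C₂ a d with mem a C₁ in e1 | mem a C₂ in e2
  ... | true | true = ⊥-elim (d refl refl)
  ... | true | false rewrite smallest⊆ (n ∸ ℓ) C a e1 = s≤s z≤n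
  ... | false | true rewrite largest⊆ r C a e2 = s≤s z≤n
  ... | false | false = z≤n

  listed-partition : ∀ i → countBlocks i (listed ++ C₁ ∷ []) ≤ℕ 1
  listed-partition i = begin
    countBlocks i (C₂ ∷ (blocks rest ++ C₁ ∷ []))
      ≡⟨ countBlocks-∷ i C₂ _ ⟩
    [ mem i C₂ ]b +ℕ countBlocks i (blocks rest ++ C₁ ∷ [])
      ≡⟨ cong ([ mem i C₂ ]b +ℕ_) (trans (countBlocks-++ i (blocks rest) (C₁ ∷ [])) (cong (k +ℕ_) (countBlocks-∷ i C₁ []))) ⟩
    [ mem i C₂ ]b +ℕ (k +ℕ ([ mem i C₁ ]b +ℕ 0))
      ≡⟨ NS.+-*-Solver.solve 3 (λ a b p → a :+ (p :+ (b :+ con 0)) := (a :+ b) :+ p) refl [ mem i C₂ ]b [ mem i C₁ ]b k ⟩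
    ([ mem i C₂ ]b +ℕ [ mem i C₁ ]b) +ℕ k
      ≤⟨ ℕP.+-monoˡ-≤ k (indicator-C₁-C₂ i (C₁-C₂-disjoint i)) ⟩
    [ mem i C ]b +ℕ k
      ≡⟨ C∷rest-partition i ⟩
    1 ∎
    where
    open ℕP.≤-Reasoning
    open NS.+-*-Solver using (_:+_; _:=_; con)
    k : ℕ
    k = countBlocks i (blocks rest)

  listed-positionOrdered : PositionOrdered (listed ++ C₁ ∷ []) y
  listed-positionOrdered =
    orderedBy⇒positionOrdered (listed ++ C₁ ∷ []) y y-ordered (countBlocks≤1⇒pairwiseDisjoint _ listed-partition)

  listedˡ-positionOrdered : PositionOrdered listed y
  listedˡ-positionOrdered = positionOrdered-++ˡ listed (C₁ ∷ []) y listed-positionOrdered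

  rest-blocks-nonempty : All Nonempty (blocks rest)
  rest-blocks-nonempty = AllP.map⁺ rest-nonempty

  rest-values : Valuation (blocks rest) y
  rest-values =
    valuation (blocks rest) y (positionOrdered-∷ C₂ (blocks rest) y listedˡ-positionOrdered) rest-blocks-nonempty

  listedˡ-values : Valuation listed y
  listedˡ-values = valuation listed y listedˡ-positionOrdered (C₂-nonempty ∷ rest-blocks-nonempty)

  mid : List (Subset n × ℚ)
  mid = Valuation.PW rest-values

  mid-blocks : map proj₁ mid ≡ blocks rest
  mid-blocks = Valuation.blocksEq rest-values

  mid-takes : Takes y mid
  mid-takes = Valuation.vals rest-values

  mid-increasing : Increasing mid
  mid-increasing = Valuation.sorted rest-values

  C₂∷mid-increasing : Increasing ((C₂ , c) ∷ mid)
  C₂∷mid-increasing = Valuation.sorted listedˡ-values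

  c<mid : All (λ b → c < proj₂ b) mid
  c<mid = AllPairs.head C₂∷mid-increasing

  y-on-C₂ : ∀ i → mem i C₂ ≡ true → y i ≡ c
  y-on-C₂ i m = proj₁ (listedˡ-positionOrdered i e₂ (here m) (here (witness∈ C₂-nonempty))) refl

  y-on-C₁ : ∀ i → mem i C₁ ≡ true → y i ≡ c + 1ℚ
  y-on-C₁ i m = y-C₁≡y-C₂+1 i e₂ (mem⇒∈ m) (proj₂ C₂-nonempty)

  mid-nonempty : All (Nonempty ∘ proj₁) mid
  mid-nonempty = AllP.map⁻ (subst (All Nonempty) (sym mid-blocks) rest-blocks-nonempty)

  mid<c+1-ifC₁ : Nonempty C₁ → All (λ b → proj₂ b < c + 1ℚ) mid
  mid<c+1-ifC₁ ne₁ = pointwise⇒values y (_< c + 1ℚ) mid pts mid-takes mid-nonempty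
    where
    e₁ = witness ne₁
    pts : ∀ i → InSome i (map proj₁ mid) → y i < c + 1ℚ
    pts i a = subst (y i <_) (y-on-C₁ e₁ (witness∈ ne₁))
      (proj₂ (listed-positionOrdered i e₁ (inSome-++ˡ (C₁ ∷ []) q') (inSome-++ʳ listed (here (witness∈ ne₁)))) lt)
      where
      q : InSome i (blocks rest)
      q = subst (InSome i) mid-blocks a
      q' : InSome i listed
      q' = there q
      lt : position (inSome-++ˡ (C₁ ∷ []) q') <ℕ position (inSome-++ʳ listed {C₁ ∷ []} (here (witness∈ ne₁)))
      lt = subst₂ _<ℕ_ (sym (position-++ˡ (C₁ ∷ []) q')) (sym (position-++ʳ listed {C₁ ∷ []} (here (witness∈ ne₁))))
             (subst (suc (position q) <ℕ_) (sym (ℕP.+-identityʳ _)) (s≤s (position<length q)))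

  lastValued : Subset n × ℚ
  lastValued = lastOf (C₂ , c) mid

  C₂∷mid-nonempty : All (Nonempty ∘ proj₁) ((C₂ , c) ∷ mid)
  C₂∷mid-nonempty = C₂-nonempty ∷ mid-nonempty

  lastValued-nonempty : Nonempty (proj₁ lastValued)
  lastValued-nonempty = all⇒last (C₂ , c) mid C₂∷mid-nonempty

  y-lastValued : y (witness lastValued-nonempty) ≡ proj₂ lastValued
  y-lastValued = all⇒last {P = λ b → ∀ i → mem i (proj₁ b) ≡ true → y i ≡ proj₂ b} (C₂ , c) mid
                   (Valuation.vals listedˡ-values) (witness lastValued-nonempty) (witness∈ lastValued-nonempty)

  Lblock≡lastValued : Lblock ≡ proj₁ lastValued
  Lblock≡lastValued = trans (cong (lastOr C₂) (sym mid-blocks)) (lastOr-blocks C₂ mid c)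

  lastValued-witness∈L : witness lastValued-nonempty ∈ Lblock
  lastValued-witness∈L =
    mem⇒∈ (subst (λ X → mem (witness lastValued-nonempty) X ≡ true) (sym Lblock≡lastValued) (witness∈ lastValued-nonempty))

  y-lastWitness<c+1 : ¬ Nonempty C₁ → y (witness lastValued-nonempty) < y e₂ + 1ℚ
  y-lastWitness<c+1 ¬ne₁ = y-L<y-C₂+1 ¬ne₁ (witness lastValued-nonempty) e₂ lastValued-witness∈L (proj₂ C₂-nonempty)

  lastValue<c+1 : ¬ Nonempty C₁ → proj₂ lastValued < c + 1ℚ
  lastValue<c+1 ¬ne₁ = subst (_< c + 1ℚ) y-lastValued (y-lastWitness<c+1 ¬ne₁)

  mid≤lastValue : All (λ b → proj₂ b ≤ proj₂ lastValued) mid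
  mid≤lastValue = All.tail (all≤last (C₂ , c) mid C₂∷mid-increasing)

  mid<c+1-ifNoC₁ : ¬ Nonempty C₁ → All (λ b → proj₂ b < c + 1ℚ) mid
  mid<c+1-ifNoC₁ ¬ne₁ =
    All.map (λ {b} le → ℚP.≤-<-trans {proj₂ b} {proj₂ lastValued} {c + 1ℚ} le (lastValue<c+1 ¬ne₁)) mid≤lastValue

  -- The values of y on the blocks after the clasp lie in (c, c + 1): they are below the value c + 1
  -- on C₁ when C₁ is nonempty, and below it by the last inequality of the face otherwise.
  mid<c+1 : All (λ b → proj₂ b < c + 1ℚ) mid
  mid<c+1 = by-cases (nonempty? C₁)
    where
    by-cases : Dec (Nonempty C₁) → All (λ b → proj₂ b < c + 1ℚ) mid
    by-cases (yes ne₁) = mid<c+1-ifC₁ ne₁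
    by-cases (no ¬ne₁) = mid<c+1-ifNoC₁ ¬ne₁

module RefinedClasp {n : ℕ} .{{_ : NonZero n}}
  (N : Necklace n) (spin : IsSpinNecklace N)
  (S : List (Subset n)) (comp : IsComposition S)
  (v : Point n) (v-ordered : OrderedBy S v) (s : ClaspSplit N) where

  open Labels {n}
  open Refinement {n}
  open ClaspSplit s
  open Clasp N spin s

  S-nonempty : All Nonempty S
  S-nonempty = proj₁ comp

  S-partition : ∀ i → countBlocks i S ≡ 1
  S-partition = proj₂ comp

  refine-rest-labels : LabelsBetween r ℓ (refine S rest)
  refine-rest-labels = refine-labelsBetween S S-partition ℓ rest rest-spinChain rest-inRange rest-nonempty 1≤ℓ ℓ≤n rest-noWrap

  S-disjoint : AllPairs Disjoint S
  S-disjoint = countBlocks≤1⇒pairwiseDisjoint S (λ i → ℕP.≤-reflexive (S-partition i))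

  S-values : Valuation S v
  S-values = valuation S v (orderedBy⇒positionOrdered S v v-ordered S-disjoint) S-nonempty

  open ValuedPieces S S-partition v S-values

  valuedSizes : List (Subset n × ℚ) → ℕ
  valuedSizes xs = sum (map (∣_∣ ∘ proj₁) xs)

  valuedSizes≡sizes : ∀ xs → valuedSizes xs ≡ sizes (map proj₁ xs)
  valuedSizes≡sizes []       = refl
  valuedSizes≡sizes (x ∷ xs) = cong (∣ proj₁ x ∣ +ℕ_) (valuedSizes≡sizes xs)

  C-pieces : List (Subset n × ℚ)
  C-pieces = valuedPieces C

  sizes-C-pieces : valuedSizes C-pieces ≡ ∣ C ∣
  sizes-C-pieces = trans (valuedSizes≡sizes C-pieces) (trans (cong sizes (blocks-valuedPieces C)) (sizes-pieces S S-partition C))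

  -- The new clasp is the piece of C at which the labels ℓ, ℓ + |P₁|, … pass n.
  n<ℓ+∣C∣ : n <ℕ ℓ +ℕ ∣ C ∣
  n<ℓ+∣C∣ = subst (n <ℕ_) (sym clasp-wraps) (ℕP.m<n+m n (proj₁ r-inRange))

  overflow : OverflowSplit (∣_∣ ∘ proj₁) n ℓ C-pieces
  overflow = overflowSplit (∣_∣ ∘ proj₁) n ℓ C-pieces ℓ≤n (subst (λ z → n <ℕ ℓ +ℕ z) (sym sizes-C-pieces) n<ℓ+∣C∣)

  open OverflowSplit overflow public using () renaming (before to pre; piece to C'-valued; after to post; split to eqCP)

  C' : Subset n
  C' = proj₁ C'-valued

  vC' : ℚ
  vC' = proj₂ C'-valued

  preBlocks postBlocks : List (Subset n)
  preBlocks = map proj₁ pre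
  postBlocks = map proj₁ post

  ℓ+pre≤n : ℓ +ℕ sizes preBlocks ≤ℕ n
  ℓ+pre≤n = subst (λ z → ℓ +ℕ z ≤ℕ n) (valuedSizes≡sizes pre) (OverflowSplit.fits overflow)

  n<ℓ+pre+∣C'∣ : n <ℕ ℓ +ℕ sizes preBlocks +ℕ ∣ C' ∣
  n<ℓ+pre+∣C'∣ = subst (λ z → n <ℕ ℓ +ℕ z +ℕ ∣ C' ∣) (valuedSizes≡sizes pre) (OverflowSplit.overflows overflow)

  pieces-C : pieces S C ≡ preBlocks ++ C' ∷ postBlocks
  pieces-C = trans (sym (blocks-valuedPieces C)) (trans (cong (map proj₁) eqCP) (map-++ proj₁ pre (C'-valued ∷ post)))

  ℓ' : ℕ
  ℓ' = lastLabel ℓ preBlocks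

  ℓ'≡ℓ+pre : ℓ' ≡ ℓ +ℕ sizes preBlocks
  ℓ'≡ℓ+pre = proj₁ (relabel-noWrap ℓ preBlocks 1≤ℓ ℓ+pre≤n)

  pre-labels : LabelsBetween ℓ (ℓ +ℕ sizes preBlocks) (relabel ℓ preBlocks)
  pre-labels = proj₂ (relabel-noWrap ℓ preBlocks 1≤ℓ ℓ+pre≤n)

  ℓ'≤n : ℓ' ≤ℕ n
  ℓ'≤n = subst (_≤ℕ n) (sym ℓ'≡ℓ+pre) ℓ+pre≤n

  ℓ≤ℓ' : ℓ ≤ℕ ℓ'
  ℓ≤ℓ' = subst (ℓ ≤ℕ_) (sym ℓ'≡ℓ+pre) (ℕP.m≤m+n ℓ _)

  ρ : ℕ
  ρ = nextLabel ℓ' C'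

  n<ℓ'+∣C'∣ : n <ℕ ℓ' +ℕ ∣ C' ∣
  n<ℓ'+∣C'∣ = subst (λ z → n <ℕ z +ℕ ∣ C' ∣) (sym ℓ'≡ℓ+pre) n<ℓ+pre+∣C'∣

  ρ≡ℓ'+∣C'∣∸n : ρ ≡ ℓ' +ℕ ∣ C' ∣ ∸ n
  ρ≡ℓ'+∣C'∣∸n = nextLabel-wrap (ℓ' +ℕ ∣ C' ∣) n<ℓ'+∣C'∣ (ℕP.+-mono-≤ ℓ'≤n (∣p∣≤n C'))

  new-clasp-wraps : ℓ' +ℕ ∣ C' ∣ ≡ ρ +ℕ n
  new-clasp-wraps = sym (trans (cong (_+ℕ n) ρ≡ℓ'+∣C'∣∸n) (ℕP.m∸n+n≡m (ℕP.<⇒≤ n<ℓ'+∣C'∣)))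

  sizes-pieces-C : sizes preBlocks +ℕ (∣ C' ∣ +ℕ sizes postBlocks) ≡ ∣ C ∣
  sizes-pieces-C = trans (sym (sizes-++ preBlocks (C' ∷ postBlocks))) (trans (cong sizes (sym pieces-C)) (sizes-pieces S S-partition C))

  ρ+post≡r : ρ +ℕ sizes postBlocks ≡ r
  ρ+post≡r = ℕP.+-cancelʳ-≡ n _ _ (begin
    ρ +ℕ sizes postBlocks +ℕ n
      ≡⟨ NS.+-*-Solver.solve 3 (λ a b c → (a :+ b) :+ c := (a :+ c) :+ b) refl ρ (sizes postBlocks) n ⟩
    ρ +ℕ n +ℕ sizes postBlocks ≡⟨ cong (_+ℕ sizes postBlocks) (sym new-clasp-wraps) ⟩
    ℓ' +ℕ ∣ C' ∣ +ℕ sizes postBlocks ≡⟨ cong (λ z → z +ℕ ∣ C' ∣ +ℕ sizes postBlocks) ℓ'≡ℓ+pre ⟩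
    ℓ +ℕ sizes preBlocks +ℕ ∣ C' ∣ +ℕ sizes postBlocks
      ≡⟨ NS.+-*-Solver.solve 4 (λ a b c d → ((a :+ b) :+ c) :+ d := a :+ (b :+ (c :+ d))) refl ℓ (sizes preBlocks) ∣ C' ∣ (sizes postBlocks) ⟩
    ℓ +ℕ (sizes preBlocks +ℕ (∣ C' ∣ +ℕ sizes postBlocks)) ≡⟨ cong (ℓ +ℕ_) sizes-pieces-C ⟩
    ℓ +ℕ ∣ C ∣ ≡⟨ clasp-wraps ⟩
    r +ℕ n ∎)
    where
    open ≡-Reasoning
    open NS.+-*-Solver using (_:+_; _:=_)

  1≤ρ : 1 ≤ℕ ρ
  1≤ρ = proj₁ (nextLabel-inRange ℓ' C')

  ρ≤r : ρ ≤ℕ r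
  ρ≤r = subst (ρ ≤ℕ_) ρ+post≡r (ℕP.m≤m+n ρ _)

  post-labels : LabelsBetween ρ (ρ +ℕ sizes postBlocks) (relabel ρ postBlocks)
  post-labels = proj₂ (relabel-noWrap ρ postBlocks 1≤ρ (subst (_≤ℕ n) (sym ρ+post≡r) (proj₂ r-inRange)))

  ys' : Necklace n
  ys' = refine S ys ++ relabel ℓ preBlocks

  zs' : Necklace n
  zs' = relabel ρ postBlocks ++ refine S zs

  split' : refine S N ≡ ys' ++ (C' , ℓ') ∷ zs'
  split' = begin
    refine S N ≡⟨ cong (refine S) split ⟩
    refine S (ys ++ (C , ℓ) ∷ zs) ≡⟨ refine-++ S ys ((C , ℓ) ∷ zs) ⟩
    refine S ys ++ (relabel ℓ (pieces S C) ++ refine S zs)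
      ≡⟨ cong (λ P → refine S ys ++ (relabel ℓ P ++ refine S zs)) pieces-C ⟩
    refine S ys ++ (relabel ℓ (preBlocks ++ C' ∷ postBlocks) ++ refine S zs)
      ≡⟨ cong (λ X → refine S ys ++ (X ++ refine S zs)) (relabel-++ ℓ preBlocks (C' ∷ postBlocks)) ⟩
    refine S ys ++ ((relabel ℓ preBlocks ++ (C' , ℓ') ∷ relabel ρ postBlocks) ++ refine S zs)
      ≡⟨ cong (refine S ys ++_) (++-assoc (relabel ℓ preBlocks) ((C' , ℓ') ∷ relabel ρ postBlocks) (refine S zs)) ⟩
    refine S ys ++ (relabel ℓ preBlocks ++ (C' , ℓ') ∷ zs')
      ≡⟨ sym (++-assoc (refine S ys) (relabel ℓ preBlocks) ((C' , ℓ') ∷ zs')) ⟩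
    ys' ++ (C' , ℓ') ∷ zs' ∎
    where open ≡-Reasoning

  headLabel-relabel : ∀ (P : List (Subset n × ℚ)) → headLabel (lastLabel ℓ (map proj₁ P)) (relabel ℓ (map proj₁ P)) ≡ ℓ
  headLabel-relabel [] = refl
  headLabel-relabel (x ∷ P) = refl

  headLabel-after-clasp : ∀ (P : List (Subset n × ℚ)) → ρ +ℕ sizes (map proj₁ P) ≡ r →
           headLabel ℓ' ((relabel ρ (map proj₁ P) ++ refine S zs) ++ ys') ≡ ρ
  headLabel-after-clasp (x ∷ P) _ = refl
  headLabel-after-clasp [] e = begin
    headLabel ℓ' (refine S zs ++ (refine S ys ++ relabel ℓ preBlocks))
      ≡⟨ cong (headLabel ℓ') (sym (++-assoc (refine S zs) (refine S ys) (relabel ℓ preBlocks))) ⟩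
    headLabel ℓ' ((refine S zs ++ refine S ys) ++ relabel ℓ preBlocks)
      ≡⟨ cong (λ X → headLabel ℓ' (X ++ relabel ℓ preBlocks)) (sym (refine-++ S zs ys)) ⟩
    headLabel ℓ' (refine S rest ++ relabel ℓ preBlocks)
      ≡⟨ headLabel-refine-++ S S-partition ℓ' rest (relabel ℓ preBlocks) rest-nonempty ⟩
    headLabel (headLabel ℓ' (relabel ℓ preBlocks)) rest ≡⟨ cong (λ d → headLabel d rest) (headLabel-relabel pre) ⟩
    r ≡⟨ sym (trans (sym (ℕP.+-identityʳ ρ)) e) ⟩
    ρ ∎
    where open ≡-Reasoning

  r' : ℕ
  r' = headLabel ℓ' (zs' ++ ys')

  r'≡ρ : r' ≡ ρ
  r'≡ρ = headLabel-after-clasp post ρ+post≡r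

  refine-zs-ys-labels : LabelsBetween r ℓ (refine S zs) × LabelsBetween r ℓ (refine S ys)
  refine-zs-ys-labels = AllP.++⁻ (refine S zs) (subst (LabelsBetween r ℓ) (refine-++ S zs ys) refine-rest-labels)

  all-refine-N : ∀ {P : Subset n × ℕ → Set} → All P (refine S ys) → All P (relabel ℓ preBlocks) → P (C' , ℓ') →
    All P (relabel ρ postBlocks) → All P (refine S zs) → All P (refine S N)
  all-refine-N {P} a b c d e = subst (All P) (sym split') (AllP.++⁺ (AllP.++⁺ a b) (c ∷ AllP.++⁺ d e))

  inMax' : All (λ e → proj₂ e ≤ℕ ℓ') (refine S N)
  inMax' = all-refine-N
    (All.map (λ h → ℕP.≤-trans (proj₂ h) ℓ≤ℓ') (proj₂ refine-zs-ys-labels))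
    (All.map (λ h → subst (_ ≤ℕ_) (sym ℓ'≡ℓ+pre) (proj₂ h)) pre-labels)
    ℕP.≤-refl
    (All.map (λ h → ℕP.≤-trans (proj₂ h) (ℕP.≤-trans (ℕP.≤-reflexive ρ+post≡r) (ℕP.≤-trans r≤ℓ ℓ≤ℓ'))) post-labels)
    (All.map (λ h → ℕP.≤-trans (proj₂ h) ℓ≤ℓ') (proj₁ refine-zs-ys-labels))

  outMin' : All (λ e → r' ≤ℕ proj₂ e) (refine S N)
  outMin' = subst (λ z → All (λ e → z ≤ℕ proj₂ e) (refine S N)) (sym r'≡ρ) (all-refine-N
    (All.map (λ h → ℕP.≤-trans ρ≤r (proj₁ h)) (proj₂ refine-zs-ys-labels))
    (All.map (λ h → ℕP.≤-trans ρ≤r (ℕP.≤-trans r≤ℓ (proj₁ h))) pre-labels)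
    (ℕP.≤-trans ρ≤r (ℕP.≤-trans r≤ℓ ℓ≤ℓ'))
    (All.map proj₁ post-labels)
    (All.map (λ h → ℕP.≤-trans ρ≤r (proj₁ h)) (proj₁ refine-zs-ys-labels)))

  s' : ClaspSplit (refine S N)
  s' = record { ys = ys' ; C = C' ; ℓ = ℓ' ; zs = zs' ; split = split' ; inMax = inMax' ; outMin = outMin' }

  C-pieces-pieceOf : All (PieceOf C) (pre ++ C'-valued ∷ post)
  C-pieces-pieceOf = subst (All (PieceOf C)) eqCP (valuedPieces-pieceOf C)

  C-pieces-increasing : Increasing (pre ++ C'-valued ∷ post)
  C-pieces-increasing = subst (AllPairs (λ a b → proj₂ a < proj₂ b)) eqCP (valuedPieces-increasing C)

  C-pieces-nonempty : All (Nonempty ∘ proj₁) (pre ++ C'-valued ∷ post)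
  C-pieces-nonempty = subst (All (Nonempty ∘ proj₁)) eqCP (valuedPieces-nonempty C)

  C-pieces-split : Increasing pre × Increasing (C'-valued ∷ post) ×
                   All (λ a → All (λ b → proj₂ a < proj₂ b) (C'-valued ∷ post)) pre
  C-pieces-split = AllPairs-++⁻ pre C-pieces-increasing

  pre-increasing : Increasing pre
  pre-increasing = proj₁ C-pieces-split

  post-increasing : Increasing post
  post-increasing = AllPairs.tail (proj₁ (proj₂ C-pieces-split))

  vC'<post : All (λ b → vC' < proj₂ b) post
  vC'<post = AllPairs.head (proj₁ (proj₂ C-pieces-split))

  pre<vC' : All (λ b → proj₂ b < vC') pre
  pre<vC' = All.map All.head (proj₂ (proj₂ C-pieces-split))

  pre-pieceOf : All (PieceOf C) pre
  pre-pieceOf = AllP.++⁻ˡ pre C-pieces-pieceOf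

  C'-pieceOf : PieceOf C C'-valued
  C'-pieceOf = All.head (AllP.++⁻ʳ pre C-pieces-pieceOf)

  post-pieceOf : All (PieceOf C) post
  post-pieceOf = All.tail (AllP.++⁻ʳ pre C-pieces-pieceOf)

  pre-nonempty : All (Nonempty ∘ proj₁) pre
  pre-nonempty = AllP.++⁻ˡ pre C-pieces-nonempty

  C'-nonempty : Nonempty C'
  C'-nonempty = All.head (AllP.++⁻ʳ pre C-pieces-nonempty)

  post-nonempty : All (Nonempty ∘ proj₁) post
  post-nonempty = All.tail (AllP.++⁻ʳ pre C-pieces-nonempty)

  pieces-C-partition : ∀ i → countBlocks i preBlocks +ℕ ([ mem i C' ]b +ℕ countBlocks i postBlocks) ≤ℕ 1
  pieces-C-partition i = subst (_≤ℕ 1) e ([b]≤1 (mem i C))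
    where
    e : [ mem i C ]b ≡ countBlocks i preBlocks +ℕ ([ mem i C' ]b +ℕ countBlocks i postBlocks)
    e = trans (sym (countBlocks-pieces S S-partition i C)) (trans (cong (countBlocks i) pieces-C)
          (trans (countBlocks-++ i preBlocks (C' ∷ postBlocks)) (cong (countBlocks i preBlocks +ℕ_) (countBlocks-∷ i C' postBlocks))))

  ∈C'⇒∉pre : ∀ i → mem i C' ≡ true → All (λ P → mem i P ≡ false) preBlocks
  ∈C'⇒∉pre i m = countBlocks≡0⇒∉ i preBlocks (ℕP.n≤0⇒n≡0 (ℕP.+-cancelʳ-≤ 1 _ 0 le))
    where
    le : countBlocks i preBlocks +ℕ 1 ≤ℕ 0 +ℕ 1
    le = ℕP.≤-trans (ℕP.+-monoʳ-≤ (countBlocks i preBlocks)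
                       (ℕP.≤-trans (ℕP.≤-reflexive (cong [_]b (sym m))) (ℕP.m≤m+n [ mem i C' ]b _)))
                    (pieces-C-partition i)

  ∈post⇒∉pre∪C' : ∀ i → InSome i postBlocks → All (λ P → mem i P ≡ false) preBlocks × (mem i C' ≡ false)
  ∈post⇒∉pre∪C' i a =
    countBlocks≡0⇒∉ i preBlocks (ℕP.n≤0⇒n≡0 (ℕP.+-cancelʳ-≤ 1 _ 0 le1')) , [b]≤0⇒false (ℕP.+-cancelʳ-≤ 1 _ 0 le2')
    where
    k = countBlocks i postBlocks
    k≥1 : 1 ≤ℕ k
    k≥1 = inSome⇒countBlocks≥1 i postBlocks a
    le1' : countBlocks i preBlocks +ℕ 1 ≤ℕ 0 +ℕ 1
    le1' = ℕP.≤-trans (ℕP.+-monoʳ-≤ (countBlocks i preBlocks) (ℕP.≤-trans k≥1 (ℕP.m≤n+m k [ mem i C' ]b))) (pieces-C-partition i)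
    le2' : [ mem i C' ]b +ℕ 1 ≤ℕ 0 +ℕ 1
    le2' = ℕP.≤-trans (ℕP.+-monoʳ-≤ [ mem i C' ]b k≥1) (ℕP.≤-trans (ℕP.m≤n+m _ (countBlocks i preBlocks)) (pieces-C-partition i))

  new-clasp-wraps' : ℓ' +ℕ ∣ C' ∣ ≡ r' +ℕ n
  new-clasp-wraps' = trans new-clasp-wraps (cong (_+ℕ n) (sym r'≡ρ))

  C₁' : Subset n
  C₁' = smallest (n ∸ ℓ') C'

  C₂' : Subset n
  C₂' = largest r' C'

  C₁'-C₂'-disjoint : ∀ i → mem i C₁' ≡ true → mem i C₂' ≡ true → ⊥
  C₁'-C₂'-disjoint = smallest-largest-apart C' ℓ'≤n new-clasp-wraps'

  C₁'-C₂'-cover : ∀ i → mem i C' ≡ true → (mem i C₁' ≡ true) ⊎ (mem i C₂' ≡ true)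
  C₁'-C₂'-cover = smallest-largest-split C' ℓ'≤n new-clasp-wraps'

  ∉C⇒∉pre : ∀ i → mem i C ≡ false → All (λ P → mem i P ≡ false) preBlocks
  ∉C⇒∉pre i nc = AllP.map⁺ (All.map (λ {e} h → mem-false-⊆ {P = proj₁ e} {Q = C} i (λ m → proj₂ (h i m)) nc) pre-pieceOf)

  C₁'⊆C' : ∀ i → mem i C₁' ≡ true → mem i C' ≡ true
  C₁'⊆C' i = smallest⊆ (n ∸ ℓ') C' i

  C₂'⊆C' : ∀ i → mem i C₂' ≡ true → mem i C' ≡ true
  C₂'⊆C' i = largest⊆ r' C' i

  C'⊆C : ∀ i → mem i C' ≡ true → mem i C ≡ true
  C'⊆C i m = proj₂ (C'-pieceOf i m)

module MovedFace {n : ℕ} .{{_ : NonZero n}}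
  (N : Necklace n) (spin : IsSpinNecklace N)
  (S : List (Subset n)) (comp : IsComposition S)
  (lam v : Point n) (ℓv : Fin n → ℤ) (ℓv∈L : InL ℓv) (y∈V : InV (shift lam ℓv))
  (s : ClaspSplit N) (y-inFace : AffFaceCond s (shift lam ℓv)) (v∈V : InV v) (v-ordered : OrderedBy S v) where

  open Labels {n}
  open Refinement {n}
  open ClaspSplit s
  open Clasp N spin s
  open OldFace N spin s (shift lam ℓv) y-inFace
  open RefinedClasp N spin S comp v v-ordered s
  open ValuedPieces S S-partition v S-values

  y : Point n
  y = shift lam ℓv

  -- The new representative: C₁ moves down by one, and the pieces of C before C' and C₁' move up by one,
  -- so that on C the values become c and c + 1 around the new clasp.
  U : Subset n
  U = unionAll preBlocks C₁'

  ∉C⇒∉U : ∀ i → mem i C ≡ false → mem i U ≡ false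
  ∉C⇒∉U i nc =
    mem-unionAll-none i preBlocks C₁' (∉C⇒∉pre i nc) (mem-false-⊆ {P = C₁'} {Q = C} i (λ m → C'⊆C i (C₁'⊆C' i m)) nc)

  ∉C⇒∉C₁ : ∀ i → mem i C ≡ false → mem i C₁ ≡ false
  ∉C⇒∉C₁ i nc = mem-false-⊆ {P = C₁} {Q = C} i (smallest⊆ (n ∸ ℓ) C i) nc

  y' : Point n
  y' i = (y i - [ mem i C₁ ]ℚ) + [ mem i U ]ℚ

  y-C₁-shift : ∀ i → mem i C ≡ true → y i - [ mem i C₁ ]ℚ ≡ c
  y-C₁-shift i m = go (C₁-C₂-cover i m)
    where
    go : (mem i C₁ ≡ true) ⊎ (mem i C₂ ≡ true) → y i - [ mem i C₁ ]ℚ ≡ c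
    go (inj₁ m1) = begin
      y i - [ mem i C₁ ]ℚ ≡⟨ cong₂ _-_ (y-on-C₁ i m1) (cong [_]ℚ m1) ⟩
      (c + 1ℚ) - 1ℚ ≡⟨ solve 1 (λ c → (c :+ con 1ℚ) :- con 1ℚ := c) refl c ⟩
      c ∎
      where
      open ≡-Reasoning
      open +-*-Solver
    go (inj₂ m2) = begin
      y i - [ mem i C₁ ]ℚ ≡⟨ cong₂ _-_ (y-on-C₂ i m2) (cong [_]ℚ (¬-not (λ m1 → C₁-C₂-disjoint i m1 m2))) ⟩
      c - 0ℚ ≡⟨ ℚP.+-identityʳ c ⟩
      c ∎
      where
      open ≡-Reasoning

  y'-on-C : ∀ i → mem i C ≡ true → mem i U ≡ false → y' i ≡ c
  y'-on-C i mC eU = trans (cong₂ _+_ (y-C₁-shift i mC) (cong [_]ℚ eU)) (ℚP.+-identityʳ c)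

  y'-on-C+1 : ∀ i → mem i C ≡ true → mem i U ≡ true → y' i ≡ c + 1ℚ
  y'-on-C+1 i mC eU = cong₂ _+_ (y-C₁-shift i mC) (cong [_]ℚ eU)

  y'-off-C : ∀ i → mem i C ≡ false → y' i ≡ y i
  y'-off-C i nC = trans (cong₂ (λ a b → (y i - [ a ]ℚ) + [ b ]ℚ) (∉C⇒∉C₁ i nC) (∉C⇒∉U i nC))
                    (trans (ℚP.+-identityʳ (y i - 0ℚ)) (ℚP.+-identityʳ (y i)))

  open Perturbation y v

  -- Each block of the refined necklace carries its key (value of y', value of v). Listed from C₂' to C₁',
  -- the keys increase lexicographically, hence so do the values of y' + t v for small t > 0.
  Key : Set
  Key = Subset n × (ℚ × ℚ)

  KeyLex : Key → Key → Set
  KeyLex a b = Lex (proj₂ a) (proj₂ b)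

  KeyValues : Key → Set
  KeyValues k = ∀ i → mem i (proj₁ k) ≡ true → (y' i ≡ proj₁ (proj₂ k)) × (v i ≡ proj₂ (proj₂ k))

  KeyKinds : Key → Set
  KeyKinds k = IsLevel (proj₁ (proj₂ k)) × IsSlope (proj₂ (proj₂ k))

  atLevel : ℚ → List (Subset n × ℚ) → List Key
  atLevel b xs = map (λ e → (proj₁ e , (b , proj₂ e))) xs

  restKeys : List (Subset n × ℚ) → List Key
  restKeys [] = []
  restKeys (bw ∷ ms) = atLevel (proj₂ bw) (valuedPieces (proj₁ bw)) ++ restKeys ms

  C₂'-key C₁'-key : Key
  C₂'-key = (C₂' , (c , vC'))
  C₁'-key = (C₁' , (c + 1ℚ , vC'))

  post-keys rest-keys pre-keys : List Key
  post-keys = atLevel c post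
  rest-keys = restKeys mid
  pre-keys = atLevel (c + 1ℚ) pre

  keysˡ : List Key
  keysˡ = C₂'-key ∷ post-keys ++ rest-keys ++ pre-keys

  keys : List Key
  keys = keysˡ ++ C₁'-key ∷ []

  c<c+1 : c < c + 1ℚ
  c<c+1 = subst (_< c + 1ℚ) (ℚP.+-identityʳ c) (ℚP.+-monoʳ-< c {0ℚ} {1ℚ} (ℚP.positive⁻¹ 1ℚ))

  atLevel-lex : ∀ b xs → AllPairs (λ a b → proj₂ a < proj₂ b) xs → AllPairs KeyLex (atLevel b xs)
  atLevel-lex b [] [] = []
  atLevel-lex b (x ∷ xs) (h ∷ t) = go xs h ∷ atLevel-lex b xs t
    where
    go : ∀ ys → All (λ e → proj₂ x < proj₂ e) ys → All (KeyLex (proj₁ x , (b , proj₂ x))) (atLevel b ys)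
    go [] [] = []
    go (z ∷ zs) (p ∷ ps) = inj₂ (refl , p) ∷ go zs ps

  lowerLevel-atLevel-lex : ∀ (k : Key) b xs → proj₁ (proj₂ k) < b → All (KeyLex k) (atLevel b xs)
  lowerLevel-atLevel-lex k b [] lt = []
  lowerLevel-atLevel-lex k b (x ∷ xs) lt = inj₁ lt ∷ lowerLevel-atLevel-lex k b xs lt

  sameLevel-atLevel-lex : ∀ (k : Key) xs → All (λ e → proj₂ (proj₂ k) < proj₂ e) xs → All (KeyLex k) (atLevel (proj₁ (proj₂ k)) xs)
  sameLevel-atLevel-lex k [] [] = []
  sameLevel-atLevel-lex k (x ∷ xs) (p ∷ ps) = inj₂ (refl , p) ∷ sameLevel-atLevel-lex k xs ps

  atLevel-levels : ∀ {Q : ℚ → Set} b xs → Q b → All (λ k → Q (proj₁ (proj₂ k))) (atLevel b xs)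
  atLevel-levels b [] q = []
  atLevel-levels b (x ∷ xs) q = q ∷ atLevel-levels b xs q

  restKeys-levels : ∀ {Q : ℚ → Set} ms → All (λ bw → Q (proj₂ bw)) ms → All (λ k → Q (proj₁ (proj₂ k))) (restKeys ms)
  restKeys-levels [] [] = []
  restKeys-levels (bw ∷ ms) (q ∷ qs) = AllP.++⁺ (atLevel-levels (proj₂ bw) (valuedPieces (proj₁ bw)) q) (restKeys-levels ms qs)

  lowerLevel-lex : ∀ (k : Key) ks → All (λ k' → proj₁ (proj₂ k) < proj₁ (proj₂ k')) ks → All (KeyLex k) ks
  lowerLevel-lex k ks h = All.map inj₁ h

  restKeys-lex : ∀ ms → Increasing ms → AllPairs KeyLex (restKeys ms)
  restKeys-lex [] [] = []
  restKeys-lex (bw ∷ ms) (h ∷ t) =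
    APP.++⁺ (atLevel-lex (proj₂ bw) (valuedPieces (proj₁ bw)) (valuedPieces-increasing (proj₁ bw))) (restKeys-lex ms t)
    (go (valuedPieces (proj₁ bw)))
    where
    later : All (λ k → proj₂ bw < proj₁ (proj₂ k)) (restKeys ms)
    later = restKeys-levels ms h
    go : ∀ xs → All (λ k → All (KeyLex k) (restKeys ms)) (atLevel (proj₂ bw) xs)
    go [] = []
    go (x ∷ xs) = All.map inj₁ later ∷ go xs

  keysˡ-lex : AllPairs KeyLex keysˡ
  keysˡ-lex =
    C₂'-key-first ∷
    APP.++⁺ (atLevel-lex c post post-increasing)
            (APP.++⁺ (restKeys-lex mid mid-increasing) (atLevel-lex (c + 1ℚ) pre pre-increasing) rest-keys-before-pre-keys)
            post-keys-before-others
    where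
    C₂'-key-first : All (KeyLex C₂'-key) (post-keys ++ rest-keys ++ pre-keys)
    C₂'-key-first = AllP.++⁺ (sameLevel-atLevel-lex C₂'-key post vC'<post)
                      (AllP.++⁺ (lowerLevel-lex C₂'-key rest-keys (restKeys-levels mid c<mid))
                                (lowerLevel-atLevel-lex C₂'-key (c + 1ℚ) pre c<c+1))
    rest-keys-before-pre-keys : All (λ k → All (KeyLex k) pre-keys) rest-keys
    rest-keys-before-pre-keys = All.map {P = λ k → proj₁ (proj₂ k) < c + 1ℚ}
      (λ {k} lt → lowerLevel-atLevel-lex k (c + 1ℚ) pre lt) (restKeys-levels mid mid<c+1)
    post-keys-before-others : All (λ k → All (KeyLex k) (rest-keys ++ pre-keys)) post-keys
    post-keys-before-others = go post
      where
      go : ∀ xs → All (λ k → All (KeyLex k) (rest-keys ++ pre-keys)) (atLevel c xs)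
      go []       = []
      go (x ∷ xs) = AllP.++⁺ (lowerLevel-lex (proj₁ x , (c , proj₂ x)) rest-keys (restKeys-levels mid c<mid))
                             (lowerLevel-atLevel-lex (proj₁ x , (c , proj₂ x)) (c + 1ℚ) pre c<c+1) ∷ go xs

  keysˡ-before-C₁'-key : All (λ k → KeyLex k C₁'-key) keysˡ
  keysˡ-before-C₁'-key =
    inj₁ c<c+1 ∷
    AllP.++⁺ (All.map (λ {k} e → inj₁ (subst (_< c + 1ℚ) (sym e) c<c+1)) (atLevel-levels {Q = λ z → z ≡ c} c post refl))
    (AllP.++⁺ (All.map inj₁ (restKeys-levels mid mid<c+1)) (go pre pre<vC'))
    where
    go : ∀ xs → All (λ e → proj₂ e < vC') xs → All (λ k → KeyLex k C₁'-key) (atLevel (c + 1ℚ) xs)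
    go [] [] = []
    go (x ∷ xs) (p ∷ ps) = inj₂ (refl , p) ∷ go xs ps

  keys-lex : AllPairs KeyLex keys
  keys-lex = APP.++⁺ keysˡ-lex ([] ∷ []) (All.map (_∷ []) keysˡ-before-C₁'-key)

  atLevel-values : ∀ b xs → All (λ e → ∀ i → mem i (proj₁ e) ≡ true → (y' i ≡ b) × (v i ≡ proj₂ e)) xs → All KeyValues (atLevel b xs)
  atLevel-values b [] [] = []
  atLevel-values b (x ∷ xs) (h ∷ hs) = h ∷ atLevel-values b xs hs

  C₂'-key-values : KeyValues C₂'-key
  C₂'-key-values i m = y'-on-C i mC eU , proj₁ (C'-pieceOf i mPj)
    where
    mPj : mem i C' ≡ true
    mPj = C₂'⊆C' i m
    mC : mem i C ≡ true
    mC = C'⊆C i mPj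
    eU : mem i U ≡ false
    eU = mem-unionAll-none i preBlocks C₁' (∈C'⇒∉pre i mPj) (¬-not (λ m1 → C₁'-C₂'-disjoint i m1 m))

  C₁'-key-values : KeyValues C₁'-key
  C₁'-key-values i m =
    y'-on-C+1 i (C'⊆C i (C₁'⊆C' i m)) (mem-unionAll-last i preBlocks C₁' m) , proj₁ (C'-pieceOf i (C₁'⊆C' i m))

  post-keys-values : All KeyValues post-keys
  post-keys-values = atLevel-values c post
    (All.zipWith (λ (h , a) i m → y'-on-C i (proj₂ (h i m)) (eU i (a i m)) , proj₁ (h i m)) (post-pieceOf , inSome-own post))
    where
    eU : ∀ i → InSome i postBlocks → mem i U ≡ false
    eU i a = mem-unionAll-none i preBlocks C₁' (proj₁ (∈post⇒∉pre∪C' i a))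
               (mem-false-⊆ {P = C₁'} {Q = C'} i (C₁'⊆C' i) (proj₂ (∈post⇒∉pre∪C' i a)))

  pre-keys-values : All KeyValues pre-keys
  pre-keys-values = atLevel-values (c + 1ℚ) pre
    (All.zipWith (λ (h , a) i m → y'-on-C+1 i (proj₂ (h i m)) (mem-unionAll-inSome i preBlocks C₁' (a i m)) , proj₁ (h i m))
              (pre-pieceOf , inSome-own pre))

  rest-keys-values : All KeyValues rest-keys
  rest-keys-values = go mid mid-takes (subst (λ X → ∀ i → InSome i X → mem i C ≡ false) (sym mid-blocks) inRest⇒∉C)
    where
    go : ∀ ms → Takes y ms → (∀ i → InSome i (map proj₁ ms) → mem i C ≡ false) → All KeyValues (restKeys ms)
    go [] [] _ = []
    go (bw ∷ ms) (vb ∷ vs) nc = AllP.++⁺ (atLevel-values (proj₂ bw) (valuedPieces (proj₁ bw)) (All.map (λ {e} h i m →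
          trans (y'-off-C i (nc i (here (proj₂ (h i m))))) (vb i (proj₂ (h i m))) , proj₁ (h i m)) (valuedPieces-pieceOf (proj₁ bw))))
        (go ms vs (λ i a → nc i (there a)))

  keys-values : All KeyValues keys
  keys-values = AllP.++⁺ (C₂'-key-values ∷ AllP.++⁺ post-keys-values (AllP.++⁺ rest-keys-values pre-keys-values)) (C₁'-key-values ∷ [])

  c-isLevel : IsLevel c
  c-isLevel = (e₂ , false) , sym (ℚP.+-identityʳ (y e₂))

  c+1-isLevel : IsLevel (c + 1ℚ)
  c+1-isLevel = (e₂ , true) , refl

  piece-isSlope : ∀ B (e : Subset n × ℚ) → PieceOf B e → Nonempty (proj₁ e) → IsSlope (proj₂ e)
  piece-isSlope B e h ne = witness ne , sym (proj₁ (h (witness ne) (witness∈ ne)))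

  atLevel-kinds : ∀ B b xs → IsLevel b → All (PieceOf B) xs → All (Nonempty ∘ proj₁) xs → All KeyKinds (atLevel b xs)
  atLevel-kinds B b [] bb [] [] = []
  atLevel-kinds B b (x ∷ xs) bb (h ∷ hs) (ne ∷ nes) = (bb , piece-isSlope B x h ne) ∷ atLevel-kinds B b xs bb hs nes

  restKeys-kinds : ∀ ms → Takes y ms → All (Nonempty ∘ proj₁) ms → All KeyKinds (restKeys ms)
  restKeys-kinds [] [] [] = []
  restKeys-kinds (bw ∷ ms) (vb ∷ vs) (ne ∷ nes) =
    AllP.++⁺ (atLevel-kinds (proj₁ bw) (proj₂ bw) (valuedPieces (proj₁ bw)) bb
                            (valuedPieces-pieceOf (proj₁ bw)) (valuedPieces-nonempty (proj₁ bw)))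
             (restKeys-kinds ms vs nes)
    where
    bb : IsLevel (proj₂ bw)
    bb = (witness ne , false) , trans (sym (vb (witness ne) (witness∈ ne))) (sym (ℚP.+-identityʳ (y (witness ne))))

  vC'-isSlope : IsSlope vC'
  vC'-isSlope = piece-isSlope C C'-valued C'-pieceOf C'-nonempty

  keys-kinds : All KeyKinds keys
  keys-kinds = AllP.++⁺ ((c-isLevel , vC'-isSlope) ∷ AllP.++⁺ (atLevel-kinds C c post c-isLevel post-pieceOf post-nonempty)
            (AllP.++⁺ (restKeys-kinds mid mid-takes mid-nonempty) (atLevel-kinds C (c + 1ℚ) pre c+1-isLevel pre-pieceOf pre-nonempty)))
          ((c+1-isLevel , vC'-isSlope) ∷ [])

  InSomeKey : Fin n → List Key → Set
  InSomeKey i ks = Any (λ k → mem i (proj₁ k) ≡ true) ks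

  inSome-atLevel : ∀ i b xs → Any (λ e → mem i (proj₁ e) ≡ true) xs → InSomeKey i (atLevel b xs)
  inSome-atLevel i b (x ∷ xs) (here m) = here m
  inSome-atLevel i b (x ∷ xs) (there a) = there (inSome-atLevel i b xs a)

  inSome-restKeys : ∀ i ms → InSome i (map proj₁ ms) → InSomeKey i (restKeys ms)
  inSome-restKeys i (bw ∷ ms) (here m) = AnyP.++⁺ˡ (inSome-atLevel i (proj₂ bw) (valuedPieces (proj₁ bw)) (valuedPieces-cover (proj₁ bw) i m))
  inSome-restKeys i (bw ∷ ms) (there a) = AnyP.++⁺ʳ (atLevel (proj₂ bw) (valuedPieces (proj₁ bw))) (inSome-restKeys i ms a)

  inSome-keysˡ⇒keys : ∀ i → InSomeKey i keysˡ → InSomeKey i keys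
  inSome-keysˡ⇒keys i a = AnyP.++⁺ˡ a

  any-++-∷⁻ : ∀ {P : Subset n × ℚ → Set} xs {x ys} → Any P (xs ++ x ∷ ys) → Any P xs ⊎ (P x ⊎ Any P ys)
  any-++-∷⁻ [] (here p) = inj₂ (inj₁ p)
  any-++-∷⁻ [] (there a) = inj₂ (inj₂ a)
  any-++-∷⁻ (z ∷ zs) (here p) = inj₁ (here p)
  any-++-∷⁻ (z ∷ zs) (there a) with any-++-∷⁻ zs a
  ... | inj₁ b = inj₁ (there b)
  ... | inj₂ b = inj₂ b

  inC⇒inSomeKey : ∀ i → mem i C ≡ true → InSomeKey i keys
  inC⇒inSomeKey i m = go (any-++-∷⁻ pre (subst (Any (λ e → mem i (proj₁ e) ≡ true)) eqCP (valuedPieces-cover C i m)))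
    where
    go : Any (λ e → mem i (proj₁ e) ≡ true) pre ⊎ (mem i C' ≡ true ⊎ Any (λ e → mem i (proj₁ e) ≡ true) post) → InSomeKey i keys
    go (inj₁ a) = inSome-keysˡ⇒keys i (there (AnyP.++⁺ʳ post-keys (AnyP.++⁺ʳ rest-keys (inSome-atLevel i (c + 1ℚ) pre a))))
    go (inj₂ (inj₂ a)) = inSome-keysˡ⇒keys i (there (AnyP.++⁺ˡ (inSome-atLevel i c post a)))
    go (inj₂ (inj₁ mPj)) = go2 (C₁'-C₂'-cover i mPj)
      where
      go2 : (mem i C₁' ≡ true) ⊎ (mem i C₂' ≡ true) → InSomeKey i keys
      go2 (inj₁ m1) = AnyP.++⁺ʳ keysˡ (here m1)
      go2 (inj₂ m2) = inSome-keysˡ⇒keys i (here m2)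

  keys-cover : ∀ i → InSomeKey i keys
  keys-cover i = go (mem i C) refl
    where
    go : ∀ b → mem i C ≡ b → InSomeKey i keys
    go true m = inC⇒inSomeKey i m
    go false m = inSome-keysˡ⇒keys i (there (AnyP.++⁺ʳ post-keys (AnyP.++⁺ˡ
                   (inSome-restKeys i mid (subst (InSome i) (sym mid-blocks) (∉C⇒inRest i m))))))

  blocks-atLevel : ∀ b xs → map proj₁ (atLevel b xs) ≡ map proj₁ xs
  blocks-atLevel b [] = refl
  blocks-atLevel b (x ∷ xs) = cong (proj₁ x ∷_) (blocks-atLevel b xs)

  blocks-restKeys : ∀ (M' : Necklace n) ms → map proj₁ ms ≡ blocks M' → map proj₁ (restKeys ms) ≡ blocks (refine S M')
  blocks-restKeys [] [] e = refl
  blocks-restKeys ((B , a) ∷ M') (bw ∷ ms) e = begin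
    map proj₁ (atLevel (proj₂ bw) (valuedPieces (proj₁ bw)) ++ restKeys ms)
      ≡⟨ map-++ proj₁ (atLevel (proj₂ bw) (valuedPieces (proj₁ bw))) (restKeys ms) ⟩
    map proj₁ (atLevel (proj₂ bw) (valuedPieces (proj₁ bw))) ++ map proj₁ (restKeys ms)
      ≡⟨ cong₂ _++_ (trans (blocks-atLevel (proj₂ bw) (valuedPieces (proj₁ bw))) (trans (blocks-valuedPieces (proj₁ bw)) (cong (pieces S) hd)))
                    (blocks-restKeys M' ms tl) ⟩
    pieces S B ++ blocks (refine S M') ≡⟨ cong (_++ blocks (refine S M')) (sym (blocks-relabel a (pieces S B))) ⟩
    blocks (relabel a (pieces S B)) ++ blocks (refine S M')
      ≡⟨ sym (map-++ proj₁ (relabel a (pieces S B)) (refine S M')) ⟩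
    blocks (refine S ((B , a) ∷ M')) ∎
    where
    open ≡-Reasoning
    hd : proj₁ bw ≡ B
    hd = ∷-injectiveˡ e
    tl : map proj₁ ms ≡ blocks M'
    tl = ∷-injectiveʳ e

  blocks-zs'++ys' : blocks (zs' ++ ys') ≡ postBlocks ++ (blocks (refine S rest) ++ preBlocks)
  blocks-zs'++ys' = begin
    blocks ((relabel ρ postBlocks ++ refine S zs) ++ (refine S ys ++ relabel ℓ preBlocks))
      ≡⟨ cong blocks (++-assoc (relabel ρ postBlocks) (refine S zs) (refine S ys ++ relabel ℓ preBlocks)) ⟩
    blocks (relabel ρ postBlocks ++ (refine S zs ++ (refine S ys ++ relabel ℓ preBlocks)))
      ≡⟨ cong (λ X → blocks (relabel ρ postBlocks ++ X)) (sym (++-assoc (refine S zs) (refine S ys) (relabel ℓ preBlocks))) ⟩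
    blocks (relabel ρ postBlocks ++ ((refine S zs ++ refine S ys) ++ relabel ℓ preBlocks))
      ≡⟨ cong (λ X → blocks (relabel ρ postBlocks ++ (X ++ relabel ℓ preBlocks))) (sym (refine-++ S zs ys)) ⟩
    blocks (relabel ρ postBlocks ++ (refine S rest ++ relabel ℓ preBlocks))
      ≡⟨ map-++ proj₁ (relabel ρ postBlocks) (refine S rest ++ relabel ℓ preBlocks) ⟩
    blocks (relabel ρ postBlocks) ++ blocks (refine S rest ++ relabel ℓ preBlocks)
      ≡⟨ cong₂ _++_ (blocks-relabel ρ postBlocks) (map-++ proj₁ (refine S rest) (relabel ℓ preBlocks)) ⟩
    postBlocks ++ (blocks (refine S rest) ++ blocks (relabel ℓ preBlocks))
      ≡⟨ cong (λ X → postBlocks ++ (blocks (refine S rest) ++ X)) (blocks-relabel ℓ preBlocks) ⟩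
    postBlocks ++ (blocks (refine S rest) ++ preBlocks) ∎
    where open ≡-Reasoning

  listed' : List (Subset n)
  listed' = C₂' ∷ blocks (zs' ++ ys')

  blocks-keysˡ : map proj₁ keysˡ ≡ listed'
  blocks-keysˡ = cong (C₂' ∷_) (begin
    map proj₁ (post-keys ++ rest-keys ++ pre-keys) ≡⟨ map-++ proj₁ post-keys (rest-keys ++ pre-keys) ⟩
    map proj₁ post-keys ++ map proj₁ (rest-keys ++ pre-keys)
      ≡⟨ cong (map proj₁ post-keys ++_) (map-++ proj₁ rest-keys pre-keys) ⟩
    map proj₁ post-keys ++ (map proj₁ rest-keys ++ map proj₁ pre-keys)
      ≡⟨ cong₂ (λ X Z → X ++ Z) (blocks-atLevel c post) (cong₂ _++_ (blocks-restKeys rest mid mid-blocks) (blocks-atLevel (c + 1ℚ) pre)) ⟩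
    postBlocks ++ (blocks (refine S rest) ++ preBlocks) ≡⟨ sym blocks-zs'++ys' ⟩
    blocks (zs' ++ ys') ∎)
    where open ≡-Reasoning

  blocks-keys : map proj₁ keys ≡ listed' ++ C₁' ∷ []
  blocks-keys = trans (map-++ proj₁ keysˡ (C₁'-key ∷ [])) (cong (_++ C₁' ∷ []) blocks-keysˡ)

  δ : Fin n → ℤ
  δ i = [ mem i C₁ ]ℤ ℤ.- [ mem i U ]ℤ

  ℓ'' : Fin n → ℤ
  ℓ'' i = ℓv i ℤ.+ δ i

  [C₁']≤[C'] : ∀ i → [ mem i C₁' ]b ≤ℕ [ mem i C' ]b
  [C₁']≤[C'] i = go (mem i C₁') refl
    where
    go : ∀ b → mem i C₁' ≡ b → [ b ]b ≤ℕ [ mem i C' ]b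
    go false _ = z≤n
    go true m = ℕP.≤-reflexive (cong [_]b (sym (C₁'⊆C' i m)))

  pre∷C₁'-disjoint : ∀ i → countBlocks i (preBlocks ++ C₁' ∷ []) ≤ℕ 1
  pre∷C₁'-disjoint i = ℕP.≤-trans (ℕP.≤-reflexive e) (ℕP.≤-trans (ℕP.+-monoʳ-≤ (countBlocks i preBlocks)
            (ℕP.≤-trans (ℕP.≤-reflexive (ℕP.+-identityʳ _)) (ℕP.≤-trans ([C₁']≤[C'] i) (ℕP.m≤m+n _ _)))) (pieces-C-partition i))
    where
    e : countBlocks i (preBlocks ++ C₁' ∷ []) ≡ countBlocks i preBlocks +ℕ ([ mem i C₁' ]b +ℕ 0)
    e = trans (countBlocks-++ i preBlocks (C₁' ∷ [])) (cong (countBlocks i preBlocks +ℕ_) (countBlocks-∷ i C₁' []))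

  card-U : card U ≡ n ∸ ℓ
  card-U = begin
    card U ≡⟨ card-unionAll preBlocks C₁' pre∷C₁'-disjoint ⟩
    sizes preBlocks +ℕ card C₁'
      ≡⟨ cong (sizes preBlocks +ℕ_) (trans (sym (∣p∣≡card C₁')) (∣smallest∣≡n∸ℓ C' ℓ'≤n new-clasp-wraps')) ⟩
    sizes preBlocks +ℕ (n ∸ ℓ') ≡⟨ cong (λ z → sizes preBlocks +ℕ (n ∸ z)) ℓ'≡ℓ+pre ⟩
    sizes preBlocks +ℕ (n ∸ (ℓ +ℕ sizes preBlocks))
      ≡⟨ cong (sizes preBlocks +ℕ_) (sym (ℕP.∸-+-assoc n ℓ (sizes preBlocks))) ⟩
    sizes preBlocks +ℕ (n ∸ ℓ ∸ sizes preBlocks) ≡⟨ ℕP.m+[n∸m]≡n sPre≤ ⟩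
    n ∸ ℓ ∎
    where
    open ≡-Reasoning
    sPre≤ : sizes preBlocks ≤ℕ n ∸ ℓ
    sPre≤ = subst (_≤ℕ n ∸ ℓ) (ℕP.m+n∸m≡n ℓ (sizes preBlocks)) (ℕP.∸-monoˡ-≤ ℓ ℓ+pre≤n)

  δ∈L : sumℤ δ ≡ ℤ.+ 0
  δ∈L = begin
    sumℤ δ ≡⟨ sumℤ-+ (λ i → [ mem i C₁ ]ℤ) (λ i → ℤ.- [ mem i U ]ℤ) ⟩
    sumℤ (λ i → [ mem i C₁ ]ℤ) ℤ.+ sumℤ (λ i → ℤ.- [ mem i U ]ℤ)
      ≡⟨ cong₂ ℤ._+_ (sumℤ-indicator (λ i → mem i C₁))
                     (trans (sumℤ-neg (λ i → [ mem i U ]ℤ)) (cong ℤ.-_ (sumℤ-indicator (λ i → mem i U)))) ⟩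
    ℤ.+ card C₁ ℤ.+ ℤ.- (ℤ.+ card U)
      ≡⟨ cong (λ z → ℤ.+ z ℤ.+ ℤ.- (ℤ.+ card U))
              (trans (sym (∣p∣≡card C₁)) (trans (∣smallest∣≡n∸ℓ C ℓ≤n clasp-wraps) (sym card-U))) ⟩
    ℤ.+ card U ℤ.+ ℤ.- (ℤ.+ card U) ≡⟨ ℤP.+-inverseʳ (ℤ.+ card U) ⟩
    ℤ.+ 0 ∎
    where open ≡-Reasoning

  ℓ''∈L : InL ℓ''
  ℓ''∈L = trans (sumℤ-+ ℓv δ) (cong₂ ℤ._+_ ℓv∈L δ∈L)

  y'' : ℚ → Point n
  y'' t = shift (lam +[ t ]· v) ℓ''

  y''≡y'+tv : ∀ t i → y'' t i ≡ y' i + t * v i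
  y''≡y'+tv t i = begin
    (lam i + t * v i) - ((ℓv i ℤ.+ δ i) / 1) ≡⟨ cong (λ z → (lam i + t * v i) - z) (sym (/1-+-homo (ℓv i) (δ i))) ⟩
    (lam i + t * v i) - (ℓv i / 1 + δ i / 1)
      ≡⟨ cong (λ z → (lam i + t * v i) - (ℓv i / 1 + z)) ([]ℤ-difference/1 (mem i C₁) (mem i U)) ⟩
    (lam i + t * v i) - (ℓv i / 1 + ([ mem i C₁ ]ℚ - [ mem i U ]ℚ))
      ≡⟨ solve 6 (λ L T V A D E → (L :+ T :* V) :- (A :+ (D :- E)) := ((L :- A) :- D) :+ E :+ T :* V) refl
           (lam i) t (v i) (ℓv i / 1) ([ mem i C₁ ]ℚ) ([ mem i U ]ℚ) ⟩
    y' i + t * v i ∎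
    where
    open ≡-Reasoning
    open +-*-Solver

  y''-regroup : ∀ t i → y'' t i ≡ shift (y +[ t ]· v) δ i
  y''-regroup t i = begin
    (lam i + t * v i) - ((ℓv i ℤ.+ δ i) / 1)
      ≡⟨ cong (λ z → (lam i + t * v i) - z) (sym (/1-+-homo (ℓv i) (δ i))) ⟩
    (lam i + t * v i) - (ℓv i / 1 + δ i / 1)
      ≡⟨ solve 5 (λ L T V A D → (L :+ T :* V) :- (A :+ D) := ((L :- A) :+ T :* V) :- D) refl (lam i) t (v i) (ℓv i / 1) (δ i / 1) ⟩
    ((lam i - ℓv i / 1) + t * v i) - δ i / 1  ∎
    where
    open ≡-Reasoning
    open +-*-Solver

  y''∈V : ∀ t → InV (y'' t)
  y''∈V t = trans (sumℚ-cong (y''-regroup t)) (InV-shift (y +[ t ]· v) δ (InV-+[]· y v t y∈V v∈V) δ∈L)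

  perturbedValue : ℚ → Key → ℚ
  perturbedValue t k = proj₁ (proj₂ k) + t * proj₂ (proj₂ k)

  module AtTime (t : ℚ) (t>0 : 0ℚ < t) (t<ε : t < ε) where

    perturbed-increasing : ∀ ks → AllPairs KeyLex ks → All KeyKinds ks → AllPairs (λ a b → perturbedValue t a < perturbedValue t b) ks
    perturbed-increasing [] [] [] = []
    perturbed-increasing (k ∷ ks) (h ∷ hs) (bv ∷ bvs) = go ks h bvs ∷ perturbed-increasing ks hs bvs
      where
      go : ∀ ks' → All (KeyLex k) ks' → All KeyKinds ks' → All (λ b → perturbedValue t k < perturbedValue t b) ks'
      go [] [] [] = []
      go (k' ∷ ks') (l ∷ ls) (bv' ∷ bvs') = lex⇒perturbed< t>0 t<ε (proj₁ bv) (proj₁ bv') (proj₂ bv) (proj₂ bv') l ∷ go ks' ls bvs'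

    perturbedPair : Key → Subset n × ℚ
    perturbedPair k = (proj₁ k , perturbedValue t k)

    perturbedPairs : List (Subset n × ℚ)
    perturbedPairs = map perturbedPair keys

    perturbedPairs-increasing : Increasing perturbedPairs
    perturbedPairs-increasing = APP.map⁺ (perturbed-increasing keys keys-lex keys-kinds)

    y''-onKey : ∀ k → KeyValues k → ∀ i → mem i (proj₁ k) ≡ true → y'' t i ≡ perturbedValue t k
    y''-onKey k h i m = trans (y''≡y'+tv t i) (cong₂ (λ a b → a + t * b) (proj₁ (h i m)) (proj₂ (h i m)))

    perturbedPairs-takes : Takes (y'' t) perturbedPairs
    perturbedPairs-takes = AllP.map⁺ (All.map (λ {k} h → y''-onKey k h) keys-values)

    blocks-perturbedPairs : ∀ ks → map proj₁ (map perturbedPair ks) ≡ map proj₁ ks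
    blocks-perturbedPairs [] = refl
    blocks-perturbedPairs (k ∷ ks) = cong (proj₁ k ∷_) (blocks-perturbedPairs ks)

    perturbedPairs-cover : ∀ i → InSome i (map proj₁ perturbedPairs)
    perturbedPairs-cover i = subst (InSome i) (sym (blocks-perturbedPairs keys)) (AnyP.map⁺ (keys-cover i))

    y''-ordered : OrderedBy (listed' ++ C₁' ∷ []) (y'' t)
    y''-ordered = subst (λ X → OrderedBy X (y'' t)) (trans (blocks-perturbedPairs keys) blocks-keys)
      (orderedBy-fromValues perturbedPairs (y'' t) perturbedPairs-increasing perturbedPairs-takes perturbedPairs-cover)

    y''-C₁'≡y''-C₂'+1 : ∀ i j → i ∈ C₁' → j ∈ C₂' → y'' t i ≡ y'' t j + 1ℚ
    y''-C₁'≡y''-C₂'+1 i j mi mj = begin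
      y'' t i ≡⟨ y''-onKey C₁'-key C₁'-key-values i (∈⇒mem mi) ⟩
      (c + 1ℚ) + t * vC' ≡⟨ solve 3 (λ c t u → (c :+ con 1ℚ) :+ t :* u := (c :+ t :* u) :+ con 1ℚ) refl c t vC' ⟩
      (c + t * vC') + 1ℚ ≡⟨ cong (_+ 1ℚ) (sym (y''-onKey C₂'-key C₂'-key-values j (∈⇒mem mj))) ⟩
      y'' t j + 1ℚ ∎
      where
      open ≡-Reasoning
      open +-*-Solver

    keysˡ-values : All KeyValues keysˡ
    keysˡ-values = AllP.++⁻ˡ keysˡ keys-values

    keysˡ-kinds : All KeyKinds keysˡ
    keysˡ-kinds = AllP.++⁻ˡ keysˡ keys-kinds

    y''<C₁'-key : ∀ i ks → InSomeKey i ks → All KeyValues ks → All KeyKinds ks → All (λ k → KeyLex k C₁'-key) ks →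
                y'' t i < perturbedValue t C₁'-key
    y''<C₁'-key i (k ∷ ks) (here m) (h ∷ _) (bv ∷ _) (l ∷ _) =
      subst (_< perturbedValue t C₁'-key) (sym (y''-onKey k h i m)) (lex⇒perturbed< t>0 t<ε (proj₁ bv) c+1-isLevel (proj₂ bv) vC'-isSlope l)
    y''<C₁'-key i (k ∷ ks) (there a) (_ ∷ hs) (_ ∷ bvs) (_ ∷ ls) = y''<C₁'-key i ks a hs bvs ls

    y''-L'<y''-C₂'+1 : ¬ Nonempty C₁' → ∀ i j → i ∈ lastOr C₂' (blocks (zs' ++ ys')) → j ∈ C₂' → y'' t i < y'' t j + 1ℚ
    y''-L'<y''-C₂'+1 _ i j mi mj = subst (y'' t i <_) e (y''<C₁'-key i keysˡ aK keysˡ-values keysˡ-kinds keysˡ-before-C₁'-key)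
      where
      aL : InSome i listed'
      aL = lastOr-inSome i C₂' (blocks (zs' ++ ys')) (∈⇒mem mi)
      aK : InSomeKey i keysˡ
      aK = AnyP.map⁻ (subst (InSome i) (sym blocks-keysˡ) aL)
      e : perturbedValue t C₁'-key ≡ y'' t j + 1ℚ
      e = begin
        (c + 1ℚ) + t * vC' ≡⟨ solve 3 (λ c t u → (c :+ con 1ℚ) :+ t :* u := (c :+ t :* u) :+ con 1ℚ) refl c t vC' ⟩
        (c + t * vC') + 1ℚ ≡⟨ cong (_+ 1ℚ) (sym (y''-onKey C₂'-key C₂'-key-values j (∈⇒mem mj))) ⟩
        y'' t j + 1ℚ ∎
        where
        open ≡-Reasoning
        open +-*-Solver

    y''-inFace : AffFaceCond s' (y'' t)
    y''-inFace = y''-ordered , y''-C₁'≡y''-C₂'+1 , y''-L'<y''-C₂'+1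

    y''-inTorusFace : InTorusFace (refine S N) (lam +[ t ]· v)
    y''-inTorusFace = ℓ'' , ℓ''∈L , y''∈V t , s' , y''-inFace

  result : Σ ℚ (λ ε → (0ℚ < ε) × ((t : ℚ) → 0ℚ < t → t < ε → InTorusFace (refine S N) (lam +[ t ]· v)))
  result = ε , ε-positive , λ t t>0 t<ε → AtTime.y''-inTorusFace t t>0 t<ε

proposition4p1 : (n : ℕ) → .{{_ : NonZero n}} → 2 ≤ℕ n →
    (N : Necklace n) → IsSpinNecklace N →
    (S : List (Subset n)) → IsComposition S →
    (lam v : Point n) → InTorusFace N lam → InCoxeterFace S v →
    IsSpinNecklace (refine S N) ×
    Σ ℚ (λ ε → (0ℚ < ε) ×
    ((t : ℚ) → 0ℚ < t → t < ε → InTorusFace (refine S N) (lam +[ t ]· v)))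
-- The argument does not use n ≥ 2.
proposition4p1 n _ N spin S comp lam v (ℓv , ℓv∈L , y∈V , s , y-inFace) (v∈V , v-ordered) =
  Refinement.refine-isSpinNecklace N S spin comp ,
  MovedFace.result N spin S comp lam v ℓv ℓv∈L y∈V s y-inFace v∈V v-ordered
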